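{- Let $C$ be an arithmetic circuit of size $t$ and formal degree $d$ in which all multiplication gates are binary. There is an arithmetic branching program $G$ computing the same polynomial as $C$, of size at most $t^{\log_2(2d)}+1$ and depth at most $3d-1$, whose edges are labelled by inputs of $C$ or by constants. Moreover, if all the addition gates of $C$ are ordinary additions or subtractions, then these constants are integers of absolute value at most $2^t$.
   Context: An arithmetic circuit has input gates labelled by variables or field constants (each of fan-out at most 1), multiplication gates, and addition gates, which may be weighted (computing $\sum a_ix_i$ from inputs $x_i$ with weights $a_i$); ordinary addition and subtraction gates are binary with weights $(1,1)$ and $(1,-1)$. Size is the number of gates including inputs. Formal degree: 1 for inputs, maximum of inputs' formal degrees for addition gates, sum for multiplication gates; the circuit's formal degree is that of its output. An arithmetic branching program is an edge-weighted directed acyclic graph with distinguished vertices $s,t$, computing the sum over all $s$–$t$ paths of the product of edge weights; its size is its number of vertices and its depth the maximal number of edges of an $s$–$t$ path. -}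

module Defs where

open import Level using (Level; _⊔_)
open import Algebra.Bundles using (CommutativeRing)
open import Data.Nat as ℕ using (ℕ; zero; suc; _≤_; _^_)
open import Data.Integer as ℤ using (ℤ; +_; -[1+_])
open import Data.Fin as Fin using (Fin; zero; suc; _≟_)
open import Data.Vec as Vec using (Vec; []; _∷_; lookup)
import Data.Vec.Properties as VecP
open import Data.List as List using (List; []; _∷_; concatMap; foldr; upTo)
open import Data.List.NonEmpty as List⁺ using (List⁺; _∷_)
open import Data.Product using (Σ; ∃; _×_; _,_; proj₁; proj₂)
open import Data.Sum using (_⊎_)
open import Data.Nat.ListAction using () renaming (sum to sumℕ)
open import Data.List.Relation.Unary.Any using (Any)
open import Data.Empty using (⊥)
open import Data.Unit using (⊤)
open import Data.Bool using (Bool; true; false; if_then_else_)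
open import Relation.Nullary using (¬_; does)
open import Relation.Binary.PropositionalEquality using (_≡_)

record Field (c ℓ : Level) : Set (Level.suc (c ⊔ ℓ)) where
  field
    commutativeRing : CommutativeRing c ℓ
  open CommutativeRing commutativeRing public
  field
    1≉0     : ¬ (1# ≈ 0#)
    inverse : ∀ x → ¬ (x ≈ 0#) → ∃ λ y → (x * y) ≈ 1#

module Circ {c ℓ : Level} (F : Field c ℓ) (n : ℕ) where

  open Field F using (_≈_; _+_; _*_; -_; 0#; 1#) renaming (Carrier to K)
  open import Algebra.Definitions.RawMonoid (Field.+-rawMonoid F) using () renaming (_×_ to _·ℕ_)

  fromℤ : ℤ → K
  fromℤ (+ m)      = m ·ℕ 1#
  fromℤ -[1+ m ]   = - (suc m ·ℕ 1#)

  -- Polynomials in K[x₀,…,x_{n-1}]: finite lists of terms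
  -- (coefficient, exponent vector); equality is equality of all
  -- coefficients.

  Monomial : Set
  Monomial = Vec ℕ n

  Poly : Set c
  Poly = List (K × Monomial)

  coeff : Poly → Monomial → K
  coeff []              e = 0#
  coeff ((a , m) ∷ p)   e =
    (if does (VecP.≡-dec ℕ._≟_ m e) then a else 0#) + coeff p e

  _≈P_ : Poly → Poly → Set ℓ
  p ≈P q = ∀ (e : Monomial) → coeff p e ≈ coeff q e

  constP : K → Poly
  constP a = (a , Vec.replicate n 0) ∷ []

  varP : Fin n → Poly
  varP j = (1# , Vec.updateAt (Vec.replicate n 0) j (λ _ → 1)) ∷ []

  _+P_ : Poly → Poly → Poly
  p +P q = p List.++ q

  scaleP : K → Poly → Poly
  scaleP a p = List.map (λ { (b , m) → (a * b , m) }) p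

  _*P_ : Poly → Poly → Poly
  p *P q = concatMap (λ { (a , m) →
             List.map (λ { (b , m′) → (a * b , Vec.zipWith ℕ._+_ m m′) }) q }) p

  sumP : List Poly → Poly
  sumP = foldr _+P_ []

  prodP : List Poly → Poly
  prodP = foldr _*P_ (constP 1#)

  -- A circuit with i gates is a list of gates in
  -- topological order, newest gate first; a gate placed on top of a
  -- circuit with i gates refers to its inputs by indices in Fin i
  -- (index zero = the most recent earlier gate).  Repetitions among the
  -- inputs of a gate are allowed (multi-edges).  The output gate is the
  -- top (last) gate.  Size = number of gates, including input gates.

  data Gate (i : ℕ) : Set c where
    var   : Fin n → Gate i
    const : K → Gate i
    mul   : List⁺ (Fin i) → Gate i
    add   : List⁺ (K × Fin i) → Gate i

  infixr 5 _◁_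
  data Circuit : ℕ → Set c where
    []  : Circuit 0
    _◁_ : ∀ {i} → Gate i → Circuit i → Circuit (suc i)

  gatePoly : ∀ {i} → Gate i → Vec Poly i → Poly
  gatePoly (var j)   v = varP j
  gatePoly (const a) v = constP a
  gatePoly (mul cs)  v = prodP (List.map (lookup v) (List⁺.toList cs))
  gatePoly (add ws)  v = sumP (List.map (λ { (a , k) → scaleP a (lookup v k) })
                                        (List⁺.toList ws))

  polys : ∀ {i} → Circuit i → Vec Poly i
  polys []       = []
  polys (g ◁ C)  = gatePoly g (polys C) ∷ polys C

  output : ∀ {t} → Circuit (suc t) → Poly
  output C = lookup (polys C) zero

  gateDeg : ∀ {i} → Gate i → Vec ℕ i → ℕ
  gateDeg (var j)   v = 1
  gateDeg (const a) v = 1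
  gateDeg (mul cs)  v = sumℕ (List.map (lookup v) (List⁺.toList cs))
  gateDeg (add ws)  v = List.foldr ℕ._⊔_ 0 (List.map (λ { (a , k) → lookup v k })
                                                     (List⁺.toList ws))

  degs : ∀ {i} → Circuit i → Vec ℕ i
  degs []      = []
  degs (g ◁ C) = gateDeg g (degs C) ∷ degs C

  formalDegree : ∀ {t} → Circuit (suc t) → ℕ
  formalDegree C = lookup (degs C) zero

  occurrences : ∀ {i} → Gate i → Fin i → ℕ
  occurrences (var j)   k = 0
  occurrences (const a) k = 0
  occurrences (mul cs)  k =
    List.length (List.filter (λ k′ → k′ ≟ k) (List⁺.toList cs))
  occurrences (add ws)  k =
    List.length (List.filter (λ w → proj₂ w ≟ k) (List⁺.toList ws))

  fanOut : ∀ {i} → Circuit i → Fin i → ℕ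
  fanOut (g ◁ C) zero    = 0
  fanOut (g ◁ C) (suc k) = occurrences g k ℕ.+ fanOut C k

  IsInputGate : ∀ {i} → Gate i → Set
  IsInputGate (var j)   = ⊤
  IsInputGate (const a) = ⊤
  IsInputGate (mul cs)  = ⊥
  IsInputGate (add ws)  = ⊥

  IsInput : ∀ {i} → Circuit i → Fin i → Set
  IsInput (g ◁ C) zero    = IsInputGate g
  IsInput (g ◁ C) (suc k) = IsInput C k

  AllGates : (∀ {i} → Gate i → Set ℓ) → ∀ {i} → Circuit i → Set ℓ
  AllGates P []      = Level.Lift _ ⊤
  AllGates P (g ◁ C) = P g × AllGates P C

  InputFanOut≤1 : ∀ {i} → Circuit i → Set
  InputFanOut≤1 C = ∀ k → IsInput C k → fanOut C k ≤ 1

  BinaryMul : ∀ {i} → Gate i → Set ℓ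
  BinaryMul (mul cs) = Level.Lift ℓ (List⁺.length cs ≡ 2)
  BinaryMul _        = Level.Lift ℓ ⊤

  -- ordinary addition (weights (1,1)) or subtraction (weights (1,-1))
  OrdinaryAdd : ∀ {i} → Gate i → Set ℓ
  OrdinaryAdd (add ((a , k) ∷ (b , k′) ∷ [])) = (a ≈ 1#) × ((b ≈ 1#) ⊎ (b ≈ - 1#))
  OrdinaryAdd (add _) = Level.Lift ℓ ⊥
  OrdinaryAdd _       = Level.Lift ℓ ⊤

  -- The vertices are Fin size, numbered in a topological
  -- order: every edge goes from a smaller to a larger vertex (so the graph
  -- is acyclic).  Parallel edges are allowed.

  record Edge (m : ℕ) (L : Set c) : Set c where
    constructor edge
    field
      src tgt : Fin m
      label   : L
      forward : src Fin.< tgt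

  record ABP (L : Set c) : Set c where
    field
      size  : ℕ
      s t   : Fin size
      edges : List (Edge size L)

    -- list of all paths with exactly k edges from u to v
    -- (a path = list of edges, each entry of `edges` being a distinct edge)
    paths : ℕ → Fin size → Fin size → List (List (Edge size L))
    paths zero    u v = if does (u ≟ v) then [] ∷ [] else []
    paths (suc k) u v = concatMap (λ e →
        if does (Edge.src e ≟ u)
        then List.map (e ∷_) (paths k (Edge.tgt e) v)
        else []) edges

    -- the s–t paths (every path has < size edges, so lengths ≤ size suffice)
    stPaths : List (List (Edge size L))
    stPaths = concatMap (λ k → paths k s t) (upTo (suc size))

    value : (L → Poly) → Poly
    value w = sumP (List.map (λ p → prodP (List.map (λ e → w (Edge.label e)) p))
                             stPaths)

    DepthAtMost : ℕ → Set c
    DepthAtMost D = ∀ k → Any (λ _ → ⊤) (paths k s t) → k ≤ D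

  data Label (t : ℕ) : Set c where
    inp : Fin t → Label t
    cst : K → Label t

  labelPoly : ∀ {t} → Circuit t → Label t → Poly
  labelPoly C (inp k) = lookup (polys C) k
  labelPoly C (cst a) = constP a

  ValidLabel : ∀ {t} → Circuit t → Label t → Set
  ValidLabel C (inp k) = IsInput C k
  ValidLabel C (cst a) = ⊤

  SmallIntConst : ∀ {t} → ℕ → Label t → Set (c ⊔ ℓ)
  SmallIntConst B (inp k) = Level.Lift _ ⊤
  SmallIntConst B (cst a) = ∃ λ (z : ℤ) → (ℤ.∣ z ∣ ≤ B) × Level.Lift c (a ≈ fromℤ z)

-- x ≤ t ^ (log₂ b) for natural numbers x, t ≥ 1, b ≥ 1, with real
-- exponent log₂ b, expressed exactly without reals:
-- for every rational p/q ≥ log₂ b (i.e. b^q ≤ 2^p, q ≥ 1), x^q ≤ t^p.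

infix 4 _≤_^log₂_
_≤_^log₂_ : ℕ → ℕ → ℕ → Set
x ≤ t ^log₂ b = ∀ (p q : ℕ) → 1 ≤ q → b ^ q ≤ 2 ^ p → x ^ q ≤ t ^ p

module Submission where

-- A vertex is a configuration "current gate g, stack S of pending gates",
-- standing for the polynomial g · Π S.  From it: an input gate is read
-- (edge labelled by that gate) and the stack popped; an addition gate is
-- expanded through all additions below it down to non-addition gates
-- (edges labelled by products of weights, which are ±1 for ordinary
-- additions and subtractions); a product gate pushes its factor of larger
-- degree and continues with the lighter one.  The invariant
-- deg g · 2^|S| ≤ d keeps stacks to at most K entries where
-- 2^K ≤ d < 2^(K+1), so there are t^(K+1) configurations plus the sink;
-- a potential of about 3 per unit of degree bounds the depth by 3d − 1.

open import Level using (Level; _⊔_)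
open import Defs
open import Data.Nat as ℕ using (ℕ; zero; suc; _≤_; _<_; z≤n; s≤s; _^_)

module Polynomials {c ℓ : Level} (F : Field c ℓ) (n : ℕ) where

  open import Data.Vec as Vec using (Vec; []; _∷_)
  import Data.Vec.Properties as VecP
  open import Data.List as List using (List; []; _∷_; _++_; map; concatMap)
  open import Data.List.Relation.Unary.All using (All; []; _∷_)
  open import Data.Product using (_×_; _,_; proj₁; proj₂)
  open import Relation.Binary.Bundles using (Setoid)
  open import Data.Bool using (Bool; true; false; if_then_else_)
  open import Data.Maybe using (Maybe; just; nothing)
  open import Data.Maybe.Properties using (just-injective)
  open import Relation.Nullary using (does; yes; no; contradiction)
  open import Relation.Nullary.Decidable using (dec-true; dec-false)
  open import Relation.Binary.PropositionalEquality as ≡ using (_≡_; refl)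
  import Data.Nat.Properties as ℕP

  open Field F hiding (zero) renaming (refl to ≈-refl; sym to ≈-sym; trans to ≈-trans; Carrier to K)
  open Circ F n
  open import Relation.Binary.Reasoning.Setoid setoid
  open import Algebra.Properties.CommutativeSemigroup +-commutativeSemigroup using (interchange)

  private variable
    a b : Level
    A : Set a
    B : Set b

  Σl : List A → (A → K) → K
  Σl []       f = 0#
  Σl (x ∷ xs) f = f x + Σl xs f

  Σ-cong : (xs : List A) {f g : A → K} → (∀ x → f x ≈ g x) → Σl xs f ≈ Σl xs g
  Σ-cong []       eq = ≈-refl
  Σ-cong (x ∷ xs) eq = +-cong (eq x) (Σ-cong xs eq)

  Σ-cong-All : {P : A → Set b} (xs : List A) {f g : A → K} → All P xs →
    (∀ x → P x → f x ≈ g x) → Σl xs f ≈ Σl xs g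
  Σ-cong-All []       []         eq = ≈-refl
  Σ-cong-All (x ∷ xs) (px ∷ pxs) eq = +-cong (eq x px) (Σ-cong-All xs pxs eq)

  Σ-cong≡ : (xs : List A) {f g : A → K} → (∀ x → f x ≡ g x) → Σl xs f ≡ Σl xs g
  Σ-cong≡ []       eq = refl
  Σ-cong≡ (x ∷ xs) eq = ≡.cong₂ _+_ (eq x) (Σ-cong≡ xs eq)

  Σ-++ : (xs ys : List A) (f : A → K) → Σl (xs ++ ys) f ≈ Σl xs f + Σl ys f
  Σ-++ []       ys f = ≈-sym (+-identityˡ _)
  Σ-++ (x ∷ xs) ys f = ≈-trans (+-cong ≈-refl (Σ-++ xs ys f)) (≈-sym (+-assoc _ _ _))

  Σ-map : (g : A → B) (xs : List A) (f : B → K) → Σl (map g xs) f ≡ Σl xs (λ x → f (g x))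
  Σ-map g []       f = refl
  Σ-map g (x ∷ xs) f = ≡.cong (f (g x) +_) (Σ-map g xs f)

  Σ-concatMap : (g : A → List B) (xs : List A) (f : B → K) →
    Σl (concatMap g xs) f ≈ Σl xs (λ x → Σl (g x) f)
  Σ-concatMap g []       f = ≈-refl
  Σ-concatMap g (x ∷ xs) f = ≈-trans (Σ-++ (g x) _ f) (+-cong ≈-refl (Σ-concatMap g xs f))

  Σ-+ : (xs : List A) (f g : A → K) → Σl xs (λ x → f x + g x) ≈ Σl xs f + Σl xs g
  Σ-+ []       f g = ≈-sym (+-identityˡ _)
  Σ-+ (x ∷ xs) f g = ≈-trans (+-cong ≈-refl (Σ-+ xs f g)) (interchange _ _ _ _)

  Σ-*ˡ : (k : K) (xs : List A) (f : A → K) → k * Σl xs f ≈ Σl xs (λ x → k * f x)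
  Σ-*ˡ k []       f = zeroʳ k
  Σ-*ˡ k (x ∷ xs) f = ≈-trans (distribˡ k _ _) (+-cong ≈-refl (Σ-*ˡ k xs f))

  Σ-zero : (xs : List A) {f : A → K} → (∀ x → f x ≈ 0#) → Σl xs f ≈ 0#
  Σ-zero []       eq = ≈-refl
  Σ-zero (x ∷ xs) eq = ≈-trans (+-cong (eq x) (Σ-zero xs eq)) (+-identityˡ 0#)

  Σ-swap : (xs : List A) (ys : List B) (f : A → B → K) →
    Σl xs (λ x → Σl ys (f x)) ≈ Σl ys (λ y → Σl xs (λ x → f x y))
  Σ-swap []       ys f = ≈-sym (Σ-zero ys (λ _ → ≈-refl))
  Σ-swap (x ∷ xs) ys f = ≈-trans (+-cong ≈-refl (Σ-swap xs ys f)) (≈-sym (Σ-+ ys (f x) _))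

  ite : Bool → K → K
  ite b k = if b then k else 0#

  ite-*ˡ : ∀ b k k′ → ite b (k * k′) ≈ k * ite b k′
  ite-*ˡ true  k k′ = ≈-refl
  ite-*ˡ false k k′ = ≈-sym (zeroʳ k)

  ite-cong : ∀ b {k k′} → k ≈ k′ → ite b k ≈ ite b k′
  ite-cong true  eq = eq
  ite-cong false eq = ≈-refl

  ite-Σ : ∀ b (xs : List A) (f : A → K) → Σl xs (λ x → ite b (f x)) ≈ ite b (Σl xs f)
  ite-Σ true  xs f = ≈-refl
  ite-Σ false xs f = Σ-zero xs (λ _ → ≈-refl)

  _==_ : Monomial → Monomial → Bool
  m == e = does (VecP.≡-dec ℕ._≟_ m e)

  termCoeff : Monomial → K × Monomial → K
  termCoeff e (a , m) = ite (m == e) a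

  coeff-Σ : ∀ p e → coeff p e ≡ Σl p (termCoeff e)
  coeff-Σ []            e = refl
  coeff-Σ ((a , m) ∷ p) e = ≡.cong (_ +_) (coeff-Σ p e)

  ≈P-setoid : Setoid c ℓ
  ≈P-setoid = record
    { Carrier       = Poly
    ; _≈_           = _≈P_
    ; isEquivalence = record
      { refl  = λ _ → ≈-refl
      ; sym   = λ p≈q e → ≈-sym (p≈q e)
      ; trans = λ p≈q q≈r e → ≈-trans (p≈q e) (q≈r e)
      }
    }

  coeff-++ : ∀ p q e → coeff (p ++ q) e ≈ coeff p e + coeff q e
  coeff-++ p q e = begin
    coeff (p ++ q) e             ≡⟨ coeff-Σ (p ++ q) e ⟩
    Σl (p ++ q) (termCoeff e)     ≈⟨ Σ-++ p q (termCoeff e) ⟩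
    Σl p (termCoeff e) + Σl q (termCoeff e)
      ≡⟨ ≡.sym (≡.cong₂ _+_ (coeff-Σ p e) (coeff-Σ q e)) ⟩
    coeff p e + coeff q e         ∎

  +P-cong : ∀ {p p′ q q′} → p ≈P p′ → q ≈P q′ → (p +P q) ≈P (p′ +P q′)
  +P-cong {p} {p′} {q} {q′} p≈ q≈ e =
    ≈-trans (coeff-++ p q e) (≈-trans (+-cong (p≈ e) (q≈ e)) (≈-sym (coeff-++ p′ q′ e)))

  +P-identityʳ : ∀ p → (p +P []) ≈P p
  +P-identityʳ p e = ≈-trans (coeff-++ p [] e) (+-identityʳ _)

  coeff-sumP : ∀ ps e → coeff (sumP ps) e ≈ Σl ps (λ p → coeff p e)
  coeff-sumP []       e = ≈-refl
  coeff-sumP (p ∷ ps) e = ≈-trans (coeff-++ p (sumP ps) e) (+-cong ≈-refl (coeff-sumP ps e))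

  sumP-cong : (xs : List A) {f g : A → Poly} → (∀ x → f x ≈P g x) →
    sumP (map f xs) ≈P sumP (map g xs)
  sumP-cong []       eq = λ _ → ≈-refl
  sumP-cong (x ∷ xs) {f} {g} eq = +P-cong {f x} {g x} (eq x) (sumP-cong xs eq)

  coeff-scaleP : ∀ k p e → coeff (scaleP k p) e ≈ k * coeff p e
  coeff-scaleP k []            e = ≈-sym (zeroʳ k)
  coeff-scaleP k ((b , m) ∷ p) e =
    ≈-trans (+-cong (ite-*ˡ (m == e) k b) (coeff-scaleP k p e)) (≈-sym (distribˡ k _ _))

  _⊕_ : ∀ {k} → Vec ℕ k → Vec ℕ k → Vec ℕ k
  _⊕_ = Vec.zipWith ℕ._+_

  ⊕-comm : ∀ {k} (m m′ : Vec ℕ k) → m ⊕ m′ ≡ m′ ⊕ m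
  ⊕-comm = VecP.zipWith-comm ℕP.+-comm

  ⊕-assoc : ∀ {k} (m m′ m″ : Vec ℕ k) → (m ⊕ m′) ⊕ m″ ≡ m ⊕ (m′ ⊕ m″)
  ⊕-assoc = VecP.zipWith-assoc ℕP.+-assoc

  zeros : ∀ {k} → Vec ℕ k
  zeros = Vec.replicate _ 0

  zeros-⊕ : ∀ {k} (m : Vec ℕ k) → zeros ⊕ m ≡ m
  zeros-⊕ = VecP.zipWith-identityˡ ℕP.+-identityˡ

  _⊖_ : ∀ {k} → Vec ℕ k → Vec ℕ k → Maybe (Vec ℕ k)
  [] ⊖ [] = just []
  (e ∷ es) ⊖ (m ∷ ms) with m ℕ.≤? e | es ⊖ ms
  ... | yes _ | just r  = just ((e ℕ.∸ m) ∷ r)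
  ... | yes _ | nothing = nothing
  ... | no _  | _       = nothing

  ⊖-sound : ∀ {k} (e m r : Vec ℕ k) → e ⊖ m ≡ just r → m ⊕ r ≡ e
  ⊖-sound [] [] [] eq = refl
  ⊖-sound (e ∷ es) (m ∷ ms) rs eq with m ℕ.≤? e | es ⊖ ms in eq′
  ⊖-sound (e ∷ es) (m ∷ ms) (r ∷ rs) refl | yes m≤e | just _ =
    ≡.cong₂ _∷_ (ℕP.m+[n∸m]≡n m≤e) (⊖-sound es ms rs eq′)

  ⊖-complete : ∀ {k} (m r : Vec ℕ k) → (m ⊕ r) ⊖ m ≡ just r
  ⊖-complete [] [] = refl
  ⊖-complete (m ∷ ms) (r ∷ rs) with m ℕ.≤? m ℕ.+ r | (ms ⊕ rs) ⊖ ms | ⊖-complete ms rs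
  ... | yes _ | just _ | refl = ≡.cong (λ x → just (x ∷ rs)) (ℕP.m+n∸m≡n m r)
  ... | no m≰ | _      | _    = contradiction (ℕP.m≤m+n m r) m≰

  ⊕-==-⊖ : ∀ m m′ e r → e ⊖ m ≡ just r → (m ⊕ m′) == e ≡ m′ == r
  ⊕-==-⊖ m m′ e r eq with VecP.≡-dec ℕ._≟_ m′ r
  ... | yes refl = dec-true (VecP.≡-dec ℕ._≟_ (m ⊕ m′) e) (⊖-sound e m m′ eq)
  ... | no m′≢r  = dec-false (VecP.≡-dec ℕ._≟_ (m ⊕ m′) e)
                     (λ { refl → m′≢r (just-injective (≡.trans (≡.sym (⊖-complete m m′)) eq)) })

  ⊕-==-⊖-nothing : ∀ m m′ e → e ⊖ m ≡ nothing → (m ⊕ m′) == e ≡ false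
  ⊕-==-⊖-nothing m m′ e eq = dec-false (VecP.≡-dec ℕ._≟_ (m ⊕ m′) e)
    (λ { refl → contradiction (≡.trans (≡.sym (⊖-complete m m′)) eq) λ () })

  divide : (Monomial → K) → Monomial → Monomial → K
  divide f m e with e ⊖ m
  ... | just r  = f r
  ... | nothing = 0#

  divide-cong : ∀ {f g} → (∀ e → f e ≈ g e) → ∀ m e → divide f m e ≈ divide g m e
  divide-cong eq m e with e ⊖ m
  ... | just r  = eq r
  ... | nothing = ≈-refl

  divide-Σ : (xs : List A) (f : A → Monomial → K) (m e : Monomial) →
    divide (λ e′ → Σl xs (λ x → f x e′)) m e ≈ Σl xs (λ x → divide (f x) m e)
  divide-Σ xs f m e with e ⊖ m
  ... | just r  = ≈-refl
  ... | nothing = ≈-sym (Σ-zero xs (λ _ → ≈-refl))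

  divide-zeros : ∀ f e → divide f zeros e ≡ f e
  divide-zeros f e rewrite ≡.subst (λ x → x ⊖ zeros ≡ just e) (zeros-⊕ e) (⊖-complete zeros e) = refl

  conv : Poly → (Monomial → K) → Monomial → K
  conv p f e = Σl p (λ x → proj₁ x * divide f (proj₂ x) e)

  conv-cong : (p : Poly) {f g : Monomial → K} → (∀ e → f e ≈ g e) → ∀ e → conv p f e ≈ conv p g e
  conv-cong p eq e = Σ-cong p (λ x → *-cong ≈-refl (divide-cong eq (proj₂ x) e))

  conv-Σ : (xs : List A) (p : Poly) (f : A → Monomial → K) (e : Monomial) →
    Σl xs (λ x → conv p (f x) e) ≈ conv p (λ e′ → Σl xs (λ x → f x e′)) e
  conv-Σ xs p f e = begin
    Σl xs (λ x → conv p (f x) e)                                ≈⟨ Σ-swap xs p _ ⟩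
    Σl p (λ y → Σl xs (λ x → proj₁ y * divide (f x) (proj₂ y) e))
      ≈⟨ Σ-cong p (λ y → ≈-trans (≈-sym (Σ-*ˡ (proj₁ y) xs _))
                                 (*-cong ≈-refl (≈-sym (divide-Σ xs f (proj₂ y) e)))) ⟩
    conv p (λ e′ → Σl xs (λ x → f x e′)) e                      ∎

  _·_ : K × Monomial → K × Monomial → K × Monomial
  (a , m) · (b , m′) = a * b , m ⊕ m′

  pairCoeff : Monomial → K × Monomial → K × Monomial → K
  pairCoeff e x y = termCoeff e (x · y)

  pairCoeff-comm : ∀ e x y → pairCoeff e x y ≈ pairCoeff e y x
  pairCoeff-comm e (a , m) (b , m′) = ≈-trans
    (reflexive (≡.cong (λ u → ite (u == e) (a * b)) (⊕-comm m m′)))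
    (ite-cong ((m′ ⊕ m) == e) (*-comm a b))

  pairCoeff-assoc : ∀ e x y z → termCoeff e ((x · y) · z) ≈ termCoeff e (x · (y · z))
  pairCoeff-assoc e (a , m) (b , m′) (c′ , m″) = ≈-trans
    (reflexive (≡.cong (λ u → ite (u == e) ((a * b) * c′)) (⊕-assoc m m′ m″)))
    (ite-cong ((m ⊕ (m′ ⊕ m″)) == e) (*-assoc a b c′))

  coeff-*P-pairs : ∀ p q e → coeff (p *P q) e ≈ Σl p (λ x → Σl q (pairCoeff e x))
  coeff-*P-pairs p q e = begin
    coeff (p *P q) e                            ≡⟨ coeff-Σ (p *P q) e ⟩
    Σl (p *P q) (termCoeff e)                   ≈⟨ Σ-concatMap _ p (termCoeff e) ⟩
    Σl p (λ x → Σl (map (x ·_) q) (termCoeff e)) ≡⟨ Σ-cong≡ p (λ x → Σ-map (x ·_) q (termCoeff e)) ⟩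
    Σl p (λ x → Σl q (pairCoeff e x))           ∎

  coeff-*P : ∀ p q e → coeff (p *P q) e ≈ conv p (coeff q) e
  coeff-*P p q e = ≈-trans (coeff-*P-pairs p q e) (Σ-cong p (λ x → inner (proj₁ x) (proj₂ x)))
    where
    inner : ∀ k m → Σl q (pairCoeff e (k , m)) ≈ k * divide (coeff q) m e
    inner k m with e ⊖ m in eq
    ... | just r = begin
      Σl q (pairCoeff e (k , m))
        ≡⟨ Σ-cong≡ q (λ y → ≡.cong (λ b → ite b (k * proj₁ y)) (⊕-==-⊖ m (proj₂ y) e r eq)) ⟩
      Σl q (λ y → ite (proj₂ y == r) (k * proj₁ y))  ≈⟨ Σ-cong q (λ y → ite-*ˡ _ k (proj₁ y)) ⟩
      Σl q (λ y → k * termCoeff r y)                  ≈⟨ ≈-sym (Σ-*ˡ k q (termCoeff r)) ⟩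
      k * Σl q (termCoeff r)                          ≡⟨ ≡.cong (k *_) (≡.sym (coeff-Σ q r)) ⟩
      k * coeff q r                                   ∎
    ... | nothing = ≈-trans (Σ-zero q vanish) (≈-sym (zeroʳ k))
      where
      vanish : ∀ y → pairCoeff e (k , m) y ≈ 0#
      vanish (b , my) rewrite ⊕-==-⊖-nothing m my e eq = ≈-refl

  *P-congʳ : ∀ p {q q′} → q ≈P q′ → (p *P q) ≈P (p *P q′)
  *P-congʳ p {q} {q′} eq e =
    ≈-trans (coeff-*P p q e) (≈-trans (conv-cong p eq e) (≈-sym (coeff-*P p q′ e)))

  *P-comm : ∀ p q → (p *P q) ≈P (q *P p)
  *P-comm p q e = begin
    coeff (p *P q) e                              ≈⟨ coeff-*P-pairs p q e ⟩
    Σl p (λ x → Σl q (pairCoeff e x))             ≈⟨ Σ-swap p q _ ⟩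
    Σl q (λ y → Σl p (λ x → pairCoeff e x y))     ≈⟨ Σ-cong q (λ y → Σ-cong p (λ x → pairCoeff-comm e x y)) ⟩
    Σl q (λ y → Σl p (pairCoeff e y))             ≈⟨ coeff-*P-pairs q p e ⟨
    coeff (q *P p) e                              ∎

  *P-congˡ : ∀ {p p′} q → p ≈P p′ → (p *P q) ≈P (p′ *P q)
  *P-congˡ {p} {p′} q eq e =
    ≈-trans (*P-comm p q e) (≈-trans (*P-congʳ q eq e) (*P-comm q p′ e))

  *P-distribʳ : ∀ p q r → ((p +P q) *P r) ≈P ((p *P r) +P (q *P r))
  *P-distribʳ p q r e = begin
    coeff ((p +P q) *P r) e                             ≈⟨ coeff-*P (p +P q) r e ⟩
    conv (p ++ q) (coeff r) e                           ≈⟨ Σ-++ p q _ ⟩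
    conv p (coeff r) e + conv q (coeff r) e
      ≈⟨ +-cong (≈-sym (coeff-*P p r e)) (≈-sym (coeff-*P q r e)) ⟩
    coeff (p *P r) e + coeff (q *P r) e                 ≈⟨ ≈-sym (coeff-++ (p *P r) (q *P r) e) ⟩
    coeff ((p *P r) +P (q *P r)) e                      ∎

  sumP-*P : ∀ ps r → (sumP ps *P r) ≈P sumP (map (_*P r) ps)
  sumP-*P []       r e = ≈-refl
  sumP-*P (p ∷ ps) r e =
    ≈-trans (*P-distribʳ p (sumP ps) r e) (+P-cong {p *P r} {p *P r} {sumP ps *P r} (λ _ → ≈-refl) (sumP-*P ps r) e)

  coeff-constP-*P : ∀ k p e → coeff (constP k *P p) e ≈ k * coeff p e
  coeff-constP-*P k p e = begin
    coeff (constP k *P p) e                   ≈⟨ coeff-*P (constP k) p e ⟩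
    k * divide (coeff p) zeros e + 0#         ≈⟨ +-identityʳ _ ⟩
    k * divide (coeff p) zeros e              ≡⟨ ≡.cong (k *_) (divide-zeros (coeff p) e) ⟩
    k * coeff p e                             ∎

  *P-identityʳ : ∀ p → (p *P constP 1#) ≈P p
  *P-identityʳ p e =
    ≈-trans (*P-comm p (constP 1#) e) (≈-trans (coeff-constP-*P 1# p e) (*-identityˡ _))

  *P-assoc : ∀ p q r → ((p *P q) *P r) ≈P (p *P (q *P r))
  *P-assoc p q r e = begin
    coeff ((p *P q) *P r) e                                        ≈⟨ coeff-*P-pairs (p *P q) r e ⟩
    Σl (p *P q) (λ xy → Σl r (pairCoeff e xy))                     ≈⟨ Σ-concatMap _ p _ ⟩
    Σl p (λ x → Σl (map (x ·_) q) (λ xy → Σl r (pairCoeff e xy)))  ≡⟨ Σ-cong≡ p (λ x → Σ-map (x ·_) q _) ⟩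
    Σl p (λ x → Σl q (λ y → Σl r (pairCoeff e (x · y))))
      ≈⟨ Σ-cong p (λ x → Σ-cong q (λ y → Σ-cong r (λ z → pairCoeff-assoc e x y z))) ⟩
    Σl p (λ x → Σl q (λ y → Σl r (λ z → pairCoeff e x (y · z))))
      ≡⟨ Σ-cong≡ p (λ x → Σ-cong≡ q (λ y → Σ-map (y ·_) r (pairCoeff e x))) ⟨
    Σl p (λ x → Σl q (λ y → Σl (map (y ·_) r) (pairCoeff e x)))
      ≈⟨ Σ-cong p (λ x → Σ-concatMap _ q (pairCoeff e x)) ⟨
    Σl p (λ x → Σl (q *P r) (pairCoeff e x))                       ≈⟨ coeff-*P-pairs p (q *P r) e ⟨
    coeff (p *P (q *P r)) e                                        ∎

module Programs {c ℓ : Level} (F : Field c ℓ) (n : ℕ) where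

  open import Data.Fin as Fin using (Fin; zero; suc; toℕ; fromℕ<)
  import Data.Fin.Properties as FinP
  open import Data.List as List using (List; []; _∷_; map; concatMap; allFin; length; upTo)
  import Data.List.Properties as LP
  open import Data.List.Membership.Propositional using (_∈_; find)
  open import Data.List.Membership.Propositional.Properties using (∈-allFin; ∈-map⁻; ∈-concatMap⁻)
  open import Data.List.Relation.Unary.Any as Any using (Any; here; there)
  import Data.List.Relation.Unary.Any.Properties as AnyP
  open import Data.List.Relation.Unary.All as All using (All; []; _∷_)
  import Data.List.Relation.Unary.All.Properties as AllP
  open import Data.Product using (Σ; _×_; _,_; proj₁; proj₂)
  open import Data.Bool using (Bool; true; false; if_then_else_; T)
  open import Data.Unit using (⊤; tt)
  open import Relation.Binary using (tri<; tri≈; tri>)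
  open import Relation.Nullary using (does; yes; no; Dec; contradiction)
  open import Relation.Nullary.Decidable using (dec-true; dec-false)
  open import Relation.Binary.PropositionalEquality as ≡ using (_≡_; refl)
  import Data.Nat.Properties as ℕP
  open import Data.Nat.DivMod using (_%_; [m+kn]%n≡m%n; m<n⇒m%n≡m)
  open import Data.Nat.ListAction using () renaming (sum to sumℕ)

  open Field F hiding (zero) renaming (refl to ≈-refl; sym to ≈-sym; trans to ≈-trans; Carrier to K)
  open Circ F n
  open Polynomials F n

  private variable
    a b : Level
    A : Set a
    B : Set b

  count : (A → Bool) → List A → ℕ
  count p []       = 0
  count p (x ∷ xs) = if p x then suc (count p xs) else count p xs

  count-≤ : (p : A → Bool) (xs : List A) → count p xs ≤ length xs
  count-≤ p []       = z≤n
  count-≤ p (x ∷ xs) with p x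
  ... | true  = s≤s (count-≤ p xs)
  ... | false = ℕP.m≤n⇒m≤1+n (count-≤ p xs)

  count-< : (p : A → Bool) (xs : List A) {x : A} → x ∈ xs → p x ≡ false → count p xs < length xs
  count-< p (y ∷ xs) (here refl) eq rewrite eq = s≤s (count-≤ p xs)
  count-< p (y ∷ xs) (there x∈) eq with p y
  ... | true  = s≤s (count-< p xs x∈ eq)
  ... | false = ℕP.m<n⇒m<1+n (count-< p xs x∈ eq)

  count-mono : (p q : A → Bool) → (∀ x → p x ≡ true → q x ≡ true) → (xs : List A) →
    count p xs ≤ count q xs
  count-mono p q p⇒q []       = z≤n
  count-mono p q p⇒q (x ∷ xs) with p x in px | q x in qx
  ... | true  | true  = s≤s (count-mono p q p⇒q xs)
  ... | true  | false = contradiction (≡.trans (≡.sym (p⇒q x px)) qx) (λ ())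
  ... | false | true  = ℕP.m≤n⇒m≤1+n (count-mono p q p⇒q xs)
  ... | false | false = count-mono p q p⇒q xs

  count-mono-< : (p q : A → Bool) → (∀ x → p x ≡ true → q x ≡ true) → (xs : List A) {x : A} →
    x ∈ xs → p x ≡ false → q x ≡ true → count p xs < count q xs
  count-mono-< p q p⇒q (y ∷ xs) (here refl) px qx rewrite px | qx = s≤s (count-mono p q p⇒q xs)
  count-mono-< p q p⇒q (y ∷ xs) (there x∈) px qx with p y in py | q y in qy
  ... | true  | true  = s≤s (count-mono-< p q p⇒q xs x∈ px qx)
  ... | true  | false = contradiction (≡.trans (≡.sym (p⇒q y py)) qy) (λ ())
  ... | false | true  = ℕP.m<n⇒m<1+n (count-mono-< p q p⇒q xs x∈ px qx)
  ... | false | false = count-mono-< p q p⇒q xs x∈ px qx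

  +*-injective : ∀ {N} x y a b → x < N → y < N → x ℕ.+ a ℕ.* N ≡ y ℕ.+ b ℕ.* N → x ≡ y
  +*-injective {suc N} x y a b x< y< eq = begin
    x                          ≡⟨ m<n⇒m%n≡m x< ⟨
    x % suc N                  ≡⟨ [m+kn]%n≡m%n x a (suc N) ⟨
    (x ℕ.+ a ℕ.* suc N) % suc N ≡⟨ ≡.cong (_% suc N) eq ⟩
    (y ℕ.+ b ℕ.* suc N) % suc N ≡⟨ [m+kn]%n≡m%n y b (suc N) ⟩
    y % suc N                  ≡⟨ m<n⇒m%n≡m y< ⟩
    y                          ∎
    where open ≡.≡-Reasoning

  -- Given heights h on Fin N, there is a
  -- bijective renumbering `rank` such that every step from a vertex to a
  -- vertex of smaller height goes forward.  The rank of u is the number of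
  -- vertices before u in the order "greater height first, then by index",
  -- encoded as the natural number `key`.
  module Ranking (N : ℕ) (h : Fin N → ℕ) where

    bound : ℕ
    bound = sumℕ (map h (allFin N))

    h≤bound : ∀ u → h u ≤ bound
    h≤bound u = go (allFin N) (∈-allFin u)
      where
      go : (xs : List (Fin N)) → u ∈ xs → h u ≤ sumℕ (map h xs)
      go (y ∷ xs) (here refl) = ℕP.m≤m+n (h y) _
      go (y ∷ xs) (there u∈)  = ℕP.≤-trans (go xs u∈) (ℕP.m≤n+m _ (h y))

    -- key u = index + (bound − height)·N: higher vertices get smaller keys
    key : Fin N → ℕ
    key u = toℕ u ℕ.+ (bound ℕ.∸ h u) ℕ.* N

    -- the index is the key modulo N, so distinct vertices have distinct keys
    key-injective : ∀ u v → key u ≡ key v → u ≡ v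
    key-injective u v eq = FinP.toℕ-injective
      (+*-injective (toℕ u) (toℕ v) (bound ℕ.∸ h u) (bound ℕ.∸ h v) (FinP.toℕ<n u) (FinP.toℕ<n v) eq)

    key-antitone : ∀ u v → h v < h u → key u < key v
    key-antitone u v hv<hu = begin-strict
      key u                                  <⟨ ℕP.+-monoˡ-< _ (FinP.toℕ<n u) ⟩
      N ℕ.+ (bound ℕ.∸ h u) ℕ.* N            ≤⟨ ℕP.*-monoˡ-≤ N (ℕP.∸-monoʳ-< hv<hu (h≤bound u)) ⟩
      (bound ℕ.∸ h v) ℕ.* N                  ≤⟨ ℕP.m≤n+m _ (toℕ v) ⟩
      key v                                  ∎
      where open ℕP.≤-Reasoning

    before : Fin N → Fin N → Bool
    before u v = does (key v ℕ.<? key u)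

    rankℕ : Fin N → ℕ
    rankℕ u = count (before u) (allFin N)

    rankℕ< : ∀ u → rankℕ u < N
    rankℕ< u = ≡.subst (rankℕ u <_) (LP.length-tabulate (λ i → i))
      (count-< (before u) (allFin N) (∈-allFin u) (dec-false (key u ℕ.<? key u) (ℕP.<-irrefl refl)))

    rankℕ-mono : ∀ u v → key u < key v → rankℕ u < rankℕ v
    rankℕ-mono u v lt = count-mono-< (before u) (before v) trans (allFin N) (∈-allFin u)
      (dec-false (key u ℕ.<? key u) (ℕP.<-irrefl refl)) (dec-true (key u ℕ.<? key v) lt)
      where
      trans : ∀ x → before u x ≡ true → before v x ≡ true
      trans x bx = dec-true (key x ℕ.<? key v) (ℕP.<-trans (ℕP.<ᵇ⇒< _ _ (≡.subst T (≡.sym bx) tt)) lt)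

    rank : Fin N → Fin N
    rank u = fromℕ< (rankℕ< u)

    toℕ-rank : ∀ u → toℕ (rank u) ≡ rankℕ u
    toℕ-rank u = FinP.toℕ-fromℕ< (rankℕ< u)

    rank-≡ : ∀ u v → rank u ≡ rank v → rankℕ u ≡ rankℕ v
    rank-≡ u v eq = ≡.trans (≡.sym (toℕ-rank u)) (≡.trans (≡.cong toℕ eq) (toℕ-rank v))

    rank-injective : ∀ u v → rank u ≡ rank v → u ≡ v
    rank-injective u v eq with ℕP.<-cmp (key u) (key v)
    ... | tri< lt _ _ = contradiction (rankℕ-mono u v lt) (ℕP.<-irrefl (rank-≡ u v eq))
    ... | tri≈ _ e _  = key-injective u v e
    ... | tri> _ _ gt = contradiction (rankℕ-mono v u gt) (ℕP.<-irrefl (rank-≡ v u (≡.sym eq)))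

    rank-forward : ∀ u v → h v < h u → rank u Fin.< rank v
    rank-forward u v lt =
      ≡.subst₂ _<_ (≡.sym (toℕ-rank u)) (≡.sym (toℕ-rank v)) (rankℕ-mono u v (key-antitone u v lt))

    does-rank : ∀ u v → does (rank u Fin.≟ rank v) ≡ does (u Fin.≟ v)
    does-rank u v with u Fin.≟ v
    ... | yes refl = dec-true (rank u Fin.≟ rank u) refl
    ... | no u≢v   = dec-false (rank u Fin.≟ rank v) (λ e → u≢v (rank-injective u v e))

  map-toList : ∀ {p} {P : A → Set p} {xs : List A} (f : A → B) (pxs : All P xs) →
    map (λ x → f (proj₁ x)) (All.toList pxs) ≡ map f xs
  map-toList f []         = refl
  map-toList f (px ∷ pxs) = ≡.cong (f _ ∷_) (map-toList f pxs)

  All-toList : ∀ {p q} {P : A → Set p} {Q : A → Set q} {xs : List A} (pxs : All P xs) →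
    All Q xs → All (λ x → Q (proj₁ x)) (All.toList pxs)
  All-toList []         []         = []
  All-toList (px ∷ pxs) (qx ∷ qxs) = qx ∷ All-toList pxs qxs

  sumFin : ∀ {N} → (Fin N → K) → K
  sumFin {zero}  g = 0#
  sumFin {suc N} g = g zero + sumFin (λ i → g (suc i))

  Σ-tabulate : ∀ {M} (f : Fin M → A) (g : A → K) → Σl (List.tabulate f) g ≡ sumFin (λ i → g (f i))
  Σ-tabulate {M = zero}  f g = refl
  Σ-tabulate {M = suc M} f g = ≡.cong (g (f zero) +_) (Σ-tabulate (λ i → f (suc i)) g)

  sumFin-δ : ∀ {N} (g : Fin N → K) (u : Fin N) → sumFin (λ u′ → ite (does (u′ Fin.≟ u)) (g u′)) ≈ g u
  sumFin-δ {suc N} g zero    = ≈-trans (+-cong ≈-refl (vanish N)) (+-identityʳ _)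
    where
    vanish : ∀ N → sumFin {N} (λ i → 0#) ≈ 0#
    vanish zero    = ≈-refl
    vanish (suc N) = ≈-trans (+-cong ≈-refl (vanish N)) (+-identityʳ 0#)
  sumFin-δ {suc N} g (suc u) = ≈-trans (+-identityˡ _) (sumFin-δ (λ i → g (suc i)) u)

  Σ-upTo-suc : (M : ℕ) (f : ℕ → K) → Σl (upTo (suc M)) f ≡ f 0 + Σl (upTo M) (λ k → f (suc k))
  Σ-upTo-suc M f = ≡.cong (f 0 +_) (≡.trans (≡.cong (λ ks → Σl ks f) (≡.sym (LP.map-applyUpTo (λ k → k) suc M)))
                                            (Σ-map suc (upTo M) f))

  Σ-upTo-+ : (a b : ℕ) (f : ℕ → K) → Σl (upTo (a ℕ.+ b)) f ≈ Σl (upTo a) f + Σl (upTo b) (λ k → f (a ℕ.+ k))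
  Σ-upTo-+ zero    b f = ≈-sym (+-identityˡ _)
  Σ-upTo-+ (suc a) b f = begin
    Σl (upTo (suc a ℕ.+ b)) f                         ≡⟨ Σ-upTo-suc (a ℕ.+ b) f ⟩
    f 0 + Σl (upTo (a ℕ.+ b)) (λ k → f (suc k))       ≈⟨ +-cong ≈-refl (Σ-upTo-+ a b (λ k → f (suc k))) ⟩
    f 0 + (Σl (upTo a) (λ k → f (suc k)) + Σl (upTo b) (λ k → f (suc a ℕ.+ k))) ≈⟨ +-assoc _ _ _ ⟨
    (f 0 + Σl (upTo a) (λ k → f (suc k))) + Σl (upTo b) (λ k → f (suc a ℕ.+ k))
      ≡⟨ ≡.cong (_+ Σl (upTo b) (λ k → f (suc a ℕ.+ k))) (Σ-upTo-suc a f) ⟨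
    Σl (upTo (suc a)) f + Σl (upTo b) (λ k → f (suc a ℕ.+ k)) ∎
    where open import Relation.Binary.Reasoning.Setoid setoid

  -- Renumbering the vertices by `rank` makes every edge go
  -- forward, so this is an ABP; its depth is at most h s, and any family
  -- I of polynomials satisfying the local equations
  --   I u ≈ [u = sink] + Σ_{u → v labelled l} w l · I v
  -- on an edge-closed set of vertices containing s has I s as its value.
  module FromGraph (L : Set c) (w : L → Poly) (N : ℕ) (h : Fin N → ℕ)
    (Out : Fin N → List (L × Fin N))
    (descend : ∀ u → All (λ lv → h (proj₂ lv) < h u) (Out u))
    (s sink : Fin N) where

    open Ranking N h

    OutEdge : Fin N → Set c
    OutEdge u = Σ (L × Fin N) (λ lv → h (proj₂ lv) < h u)

    label : ∀ {u} → OutEdge u → L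
    label x = proj₁ (proj₁ x)

    target : ∀ {u} → OutEdge u → Fin N
    target x = proj₂ (proj₁ x)

    out : (u : Fin N) → List (OutEdge u)
    out u = All.toList (descend u)

    toEdge : (u : Fin N) → OutEdge u → Edge N L
    toEdge u x = edge (rank u) (rank (target x)) (label x) (rank-forward u (target x) (proj₂ x))

    edgeList : List (Edge N L)
    edgeList = concatMap (λ u → map (toEdge u) (out u)) (allFin N)

    program : ABP L
    program = record { size = N ; s = rank s ; t = rank sink ; edges = edgeList }

    open ABP program using (paths; stPaths; value; DepthAtMost)

    NonEmpty : ∀ {X : Set c} → List X → Set c
    NonEmpty = Any (λ _ → ⊤)

    guarded : ∀ {X : Set} {xs : List (List (Edge N L))} (d : Dec X) →
      NonEmpty (if does d then xs else []) → X × NonEmpty xs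
    guarded (yes x) ne = x , ne

    first-edge : ∀ k i j → NonEmpty (paths (suc k) i j) →
      Σ (Edge N L) λ ed → ed ∈ edgeList × Edge.src ed ≡ i × NonEmpty (paths k (Edge.tgt ed) j)
    first-edge k i j ne with find (AnyP.concatMap⁻ _ ne)
    ... | ed , ed∈ , rest with guarded (Edge.src ed Fin.≟ i) rest
    ... | src≡i , rest′ = ed , ed∈ , src≡i , AnyP.map⁻ rest′

    edge-origin : ∀ ed → ed ∈ edgeList → Σ (Fin N) λ u → Σ (OutEdge u) λ x → ed ≡ toEdge u x
    edge-origin ed ed∈ with find (∈-concatMap⁻ (λ u → map (toEdge u) (out u)) {xs = allFin N} ed∈)
    ... | u , _ , ed∈u with ∈-map⁻ (toEdge u) ed∈u
    ... | x , _ , ed≡ = u , x , ed≡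

    edge-from : ∀ u ed → ed ∈ edgeList → Edge.src ed ≡ rank u →
      Σ (OutEdge u) λ x → Edge.tgt ed ≡ rank (target x)
    edge-from u ed ed∈ src≡ =
      let u′ , x , ed≡ = edge-origin ed ed∈
          u′≡u         = rank-injective u′ u (≡.trans (≡.cong Edge.src (≡.sym ed≡)) src≡)
      in ≡.subst (λ v → Σ (OutEdge v) λ y → Edge.tgt ed ≡ rank (target y)) u′≡u (x , ≡.cong Edge.tgt ed≡)

    length≤height : ∀ k u j → NonEmpty (paths k (rank u) j) → k ≤ h u
    length≤height zero    u j ne = z≤n
    length≤height (suc k) u j ne =
      let ed , ed∈ , src≡ , ne′ = first-edge k (rank u) j ne
          x , tgt≡              = edge-from u ed ed∈ src≡
      in ℕP.<-≤-trans (s≤s (length≤height k (target x) j (≡.subst (λ v → NonEmpty (paths k v j)) tgt≡ ne′)))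
                      (proj₂ x)

    depth : ∀ D → h s ≤ D → DepthAtMost D
    depth D hs≤D k ne = ℕP.≤-trans (length≤height k s (rank sink) ne) hs≤D

    length≤distance : ∀ k i j → NonEmpty (paths k i j) → toℕ i ℕ.+ k ≤ toℕ j
    length≤distance zero    i j ne with i Fin.≟ j
    length≤distance zero    i j ne | yes refl = ℕP.≤-reflexive (ℕP.+-identityʳ (toℕ i))
    length≤distance (suc k) i j ne with first-edge k i j ne
    ... | ed , _ , refl , ne′ = begin
      toℕ (Edge.src ed) ℕ.+ suc k  ≡⟨ ℕP.+-suc (toℕ (Edge.src ed)) k ⟩
      suc (toℕ (Edge.src ed)) ℕ.+ k ≤⟨ ℕP.+-monoˡ-≤ k (Edge.forward ed) ⟩
      toℕ (Edge.tgt ed) ℕ.+ k       ≤⟨ length≤distance k (Edge.tgt ed) j ne′ ⟩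
      toℕ j                         ∎
      where open ℕP.≤-Reasoning

    no-long-paths : ∀ k i j → N ≤ k → paths k i j ≡ []
    no-long-paths k i j N≤k with paths k i j in eq
    ... | []     = refl
    ... | _ ∷ _  = contradiction (ℕP.≤-trans (ℕP.m≤n+m k (toℕ i))
                                   (length≤distance k i j (≡.subst NonEmpty (≡.sym eq) (here tt))))
                                 (ℕP.<⇒≱ (ℕP.<-≤-trans (FinP.toℕ<n j) N≤k))

    all-labels : ∀ {r} (P : L → Set r) → (∀ u → All (λ x → P (proj₁ x)) (Out u)) →
      All (λ ed → P (Edge.label ed)) edgeList
    all-labels P hyp =
      AllP.concat⁺ (AllP.map⁺ (AllP.tabulate⁺ (λ u → AllP.map⁺ (All-toList (descend u) (hyp u)))))

    weight : List (Edge N L) → Poly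
    weight p = prodP (map (λ ed → w (Edge.label ed)) p)

    pathSum : ℕ → Fin N → Monomial → K
    pathSum k i e = Σl (paths k i (rank sink)) (λ p → coeff (weight p) e)

    value-pathSum : ∀ e → coeff (value w) e ≈ Σl (upTo (suc N)) (λ k → pathSum k (rank s) e)
    value-pathSum e = begin
      coeff (value w) e                                 ≈⟨ coeff-sumP (map weight stPaths) e ⟩
      Σl (map weight stPaths) (λ p → coeff p e)         ≡⟨ Σ-map weight stPaths _ ⟩
      Σl stPaths (λ p → coeff (weight p) e)
        ≈⟨ Σ-concatMap (λ k → paths k (rank s) (rank sink)) (upTo (suc N)) _ ⟩
      Σl (upTo (suc N)) (λ k → pathSum k (rank s) e)    ∎
      where open import Relation.Binary.Reasoning.Setoid setoid

    atSink : Fin N → Poly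
    atSink u = if does (u Fin.≟ sink) then constP 1# else []

    pathSum-zero : ∀ u e → pathSum 0 (rank u) e ≈ coeff (atSink u) e
    pathSum-zero u e rewrite does-rank u sink with does (u Fin.≟ sink)
    ... | true  = +-identityʳ _
    ... | false = ≈-refl

    Σ-edges-from : ∀ u (f : Edge N L → K) →
      Σl edgeList (λ ed → ite (does (Edge.src ed Fin.≟ rank u)) (f ed)) ≈ Σl (out u) (λ x → f (toEdge u x))
    Σ-edges-from u f = begin
      Σl edgeList (λ ed → ite (does (Edge.src ed Fin.≟ rank u)) (f ed))         ≈⟨ Σ-concatMap _ (allFin N) _ ⟩
      Σl (allFin N) (λ u′ → Σl (map (toEdge u′) (out u′)) (λ ed → ite (does (Edge.src ed Fin.≟ rank u)) (f ed)))
        ≡⟨ Σ-cong≡ (allFin N) (λ u′ → Σ-map (toEdge u′) (out u′) _) ⟩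
      Σl (allFin N) (λ u′ → Σl (out u′) (λ x → ite (does (rank u′ Fin.≟ rank u)) (f (toEdge u′ x))))
        ≡⟨ Σ-cong≡ (allFin N) (λ u′ → ≡.cong (λ b → Σl (out u′) (λ x → ite b (f (toEdge u′ x))))
                                             (does-rank u′ u)) ⟩
      Σl (allFin N) (λ u′ → Σl (out u′) (λ x → ite (does (u′ Fin.≟ u)) (f (toEdge u′ x))))
        ≈⟨ Σ-cong (allFin N) (λ u′ → ite-Σ (does (u′ Fin.≟ u)) (out u′) _) ⟩
      Σl (allFin N) (λ u′ → ite (does (u′ Fin.≟ u)) (Σl (out u′) (λ x → f (toEdge u′ x))))
        ≡⟨ Σ-tabulate {M = N} (λ i → i) _ ⟩
      sumFin (λ u′ → ite (does (u′ Fin.≟ u)) (Σl (out u′) (λ x → f (toEdge u′ x))))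
        ≈⟨ sumFin-δ (λ u′ → Σl (out u′) (λ x → f (toEdge u′ x))) u ⟩
      Σl (out u) (λ x → f (toEdge u x))                                          ∎
      where open import Relation.Binary.Reasoning.Setoid setoid

    pathSum-suc : ∀ k u e → pathSum (suc k) (rank u) e ≈
      Σl (out u) (λ x → conv (w (label x)) (pathSum k (rank (target x))) e)
    pathSum-suc k u e = begin
      pathSum (suc k) (rank u) e                                               ≈⟨ Σ-concatMap _ edgeList _ ⟩
      Σl edgeList (λ ed → Σl (starting ed (Edge.src ed Fin.≟ rank u)) (λ p → coeff (weight p) e))
        ≈⟨ Σ-cong edgeList (λ ed → first-step ed (Edge.src ed Fin.≟ rank u)) ⟩
      Σl edgeList (λ ed → ite (does (Edge.src ed Fin.≟ rank u)) (through ed))  ≈⟨ Σ-edges-from u through ⟩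
      Σl (out u) (λ x → through (toEdge u x))                                  ∎
      where
      open import Relation.Binary.Reasoning.Setoid setoid
      through : Edge N L → K
      through ed = conv (w (Edge.label ed)) (pathSum k (Edge.tgt ed)) e
      starting : ∀ {X : Set} → Edge N L → Dec X → List (List (Edge N L))
      starting ed d = if does d then map (ed ∷_) (paths k (Edge.tgt ed) (rank sink)) else []
      first-step : ∀ ed {X : Set} (d : Dec X) →
        Σl (starting ed d) (λ p → coeff (weight p) e) ≈ ite (does d) (through ed)
      first-step ed (no _)  = ≈-refl
      first-step ed (yes _) = begin
        Σl (map (ed ∷_) ps) (λ p → coeff (weight p) e)                   ≡⟨ Σ-map (ed ∷_) ps _ ⟩
        Σl ps (λ p → coeff (w (Edge.label ed) *P weight p) e)
          ≈⟨ Σ-cong ps (λ p → coeff-*P (w (Edge.label ed)) (weight p) e) ⟩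
        Σl ps (λ p → conv (w (Edge.label ed)) (coeff (weight p)) e)
          ≈⟨ conv-Σ ps (w (Edge.label ed)) (λ p → coeff (weight p)) e ⟩
        through ed                                                        ∎
        where ps = paths k (Edge.tgt ed) (rank sink)

    module Solution {r} (R : Fin N → Set r) (I : Fin N → Poly)
      (R-closed : ∀ u → R u → All (λ x → R (proj₂ x)) (Out u))
      (local : ∀ u → R u → I u ≈P (atSink u +P sumP (map (λ x → w (proj₁ x) *P I (proj₂ x)) (Out u))))
      where
      open import Relation.Binary.Reasoning.Setoid setoid

      step : ∀ u → OutEdge u → Poly
      step u x = w (label x) *P I (target x)

      local′ : ∀ u → R u → I u ≈P (atSink u +P sumP (map (step u) (out u)))
      local′ u ru e = ≈-trans (local u ru e)
        (reflexive (≡.cong (λ ps → coeff (atSink u +P sumP ps) e) (≡.sym (map-toList _ (descend u)))))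

      no-edges : ∀ u → h u ≤ 0 → out u ≡ []
      no-edges u hu with out u
      ... | []    = refl
      ... | x ∷ _ = contradiction (ℕP.<-≤-trans (proj₂ x) hu) ℕP.n≮0

      mutual
        paths-solve : ∀ M u → R u → h u ≤ M → ∀ e →
          Σl (upTo (suc M)) (λ k → pathSum k (rank u) e) ≈ coeff (I u) e
        paths-solve M u ru hu e = begin
          Σl (upTo (suc M)) (λ k → pathSum k (rank u) e)  ≡⟨ Σ-upTo-suc M _ ⟩
          pathSum 0 (rank u) e + Σl (upTo M) (λ k → pathSum (suc k) (rank u) e)
            ≈⟨ +-cong (pathSum-zero u e) (longer-paths-solve M u ru hu e) ⟩
          coeff (atSink u) e + coeff (sumP (map (step u) (out u))) e  ≈⟨ coeff-++ (atSink u) _ e ⟨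
          coeff (atSink u +P sumP (map (step u) (out u))) e          ≈⟨ local′ u ru e ⟨
          coeff (I u) e                                   ∎

        longer-paths-solve : ∀ M u → R u → h u ≤ M → ∀ e →
          Σl (upTo M) (λ k → pathSum (suc k) (rank u) e) ≈ coeff (sumP (map (step u) (out u))) e
        longer-paths-solve zero    u ru hu e rewrite no-edges u hu = ≈-refl
        longer-paths-solve (suc M) u ru hu e = begin
          Σl (upTo (suc M)) (λ k → pathSum (suc k) (rank u) e)
            ≈⟨ Σ-cong (upTo (suc M)) (λ k → pathSum-suc k u e) ⟩
          Σl (upTo (suc M)) (λ k → Σl (out u) (λ x → conv (w (label x)) (pathSum k (rank (target x))) e))
            ≈⟨ Σ-swap (upTo (suc M)) (out u) _ ⟩
          Σl (out u) (λ x → Σl (upTo (suc M)) (λ k → conv (w (label x)) (pathSum k (rank (target x))) e))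
            ≈⟨ Σ-cong (out u) (λ x → conv-Σ (upTo (suc M)) (w (label x)) (λ k → pathSum k (rank (target x))) e) ⟩
          Σl (out u) (λ x → conv (w (label x)) (λ e′ → Σl (upTo (suc M)) (λ k → pathSum k (rank (target x)) e′)) e)
            ≈⟨ Σ-cong-All (out u) (All-toList (descend u) (R-closed u ru)) (λ x rx →
                 ≈-trans (conv-cong (w (label x)) (paths-solve M (target x) rx (ℕP.≤-pred (ℕP.<-≤-trans (proj₂ x) hu))) e)
                         (≈-sym (coeff-*P (w (label x)) (I (target x)) e))) ⟩
          Σl (out u) (λ x → coeff (step u x) e)              ≡⟨ Σ-map (step u) (out u) (λ p → coeff p e) ⟨
          Σl (map (step u) (out u)) (λ p → coeff p e)        ≈⟨ coeff-sumP (map (step u) (out u)) e ⟨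
          coeff (sumP (map (step u) (out u))) e              ∎

      -- Paths longer than N vanish, so the value is I s.
      value-solution : R s → value w ≈P I s
      value-solution rs e = begin
        coeff (value w) e                                       ≈⟨ value-pathSum e ⟩
        Σl (upTo (suc N)) f                                     ≈⟨ +-identityʳ _ ⟨
        Σl (upTo (suc N)) f + 0#                                ≈⟨ +-cong ≈-refl (Σ-zero (upTo (h s)) long) ⟨
        Σl (upTo (suc N)) f + Σl (upTo (h s)) (λ k → f (suc N ℕ.+ k)) ≈⟨ Σ-upTo-+ (suc N) (h s) f ⟨
        Σl (upTo (suc N ℕ.+ h s)) f                             ≈⟨ paths-solve (N ℕ.+ h s) s rs (ℕP.m≤n+m (h s) N) e ⟩
        coeff (I s) e                                           ∎
        where
        f : ℕ → K
        f k = pathSum k (rank s) e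
        long : ∀ k → f (suc N ℕ.+ k) ≈ 0#
        long k rewrite no-long-paths (suc N ℕ.+ k) (rank s) (rank sink)
                         (ℕP.≤-trans (ℕP.n≤1+n N) (ℕP.m≤m+n (suc N) k)) = ≈-refl

module Gates {c ℓ : Level} (F : Field c ℓ) (n : ℕ) where

  open import Data.Fin using (Fin; zero; suc)
  open import Data.Vec using (lookup)
  open import Data.List as List using (List; []; _∷_; map; concatMap)
  import Data.List.Properties as LP
  open import Data.List.NonEmpty using (List⁺; _∷_; toList)
  open import Data.List.Membership.Propositional using (_∈_)
  open import Data.List.Relation.Unary.Any using (here; there)
  open import Data.List.Relation.Unary.All as All using (All; []; _∷_)
  import Data.List.Relation.Unary.All.Properties as AllP
  open import Data.Product using (_×_; _,_; proj₁; proj₂)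
  open import Data.Sum using (_⊎_; inj₁; inj₂)
  open import Data.Unit using (⊤; tt)
  open import Data.Empty using (⊥)
  open import Relation.Binary.PropositionalEquality as ≡ using (_≡_; refl)
  import Data.Nat.Properties as ℕP

  open Field F hiding (zero) renaming (refl to ≈-refl; sym to ≈-sym; trans to ≈-trans; Carrier to K)
  open Circ F n
  open Polynomials F n
  open import Algebra.Properties.Ring ring using (-1*x≈-x; -‿involutive)

  poly : ∀ {t} → Circuit t → Fin t → Poly
  poly C k = lookup (polys C) k

  deg : ∀ {t} → Circuit t → Fin t → ℕ
  deg C k = lookup (degs C) k

  -- The shape of a gate, with its inputs addressed by their position in
  -- the whole circuit: an input gate, a product of two gates, a weighted
  -- sum, or a multiplication gate that is not binary.
  data Shape (t : ℕ) : Set c where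
    input     : Shape t
    product   : Fin t → Fin t → Shape t
    lincomb   : List (K × Fin t) → Shape t
    nonBinary : Shape t

  lift : ∀ {t} → K × Fin t → K × Fin (suc t)
  lift (a , k) = a , suc k

  liftShape : ∀ {t} → Shape t → Shape (suc t)
  liftShape input         = input
  liftShape (product a b) = product (suc a) (suc b)
  liftShape (lincomb ws)  = lincomb (map lift ws)
  liftShape nonBinary     = nonBinary

  gateShape : ∀ {i} → Gate i → Shape (suc i)
  gateShape (var j)               = input
  gateShape (const a)             = input
  gateShape (mul (a ∷ b ∷ []))    = product (suc a) (suc b)
  gateShape (mul (a ∷ []))        = nonBinary
  gateShape (mul (a ∷ b ∷ _ ∷ _)) = nonBinary
  gateShape (add ws)              = lincomb (map lift (toList ws))

  shape : ∀ {t} → Circuit t → Fin t → Shape t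
  shape (g ◁ C) zero    = gateShape g
  shape (g ◁ C) (suc k) = liftShape (shape C k)

  -- Gate zero is the output; the inputs of products are never the output.
  NotOutput : ∀ {t} → Fin t → Set
  NotOutput zero    = ⊥
  NotOutput (suc _) = ⊤

  ShapeSound : ∀ {t} → Circuit t → Fin t → Shape t → Set (c ⊔ ℓ)
  ShapeSound C k input         = Level.Lift (c ⊔ ℓ) (IsInput C k × deg C k ≡ 1)
  ShapeSound C k (product a b) = Level.Lift (c ⊔ ℓ)
    ((poly C k ≈P (poly C a *P poly C b)) × deg C k ≡ deg C a ℕ.+ deg C b × NotOutput a × NotOutput b)
  ShapeSound C k (lincomb ws)  = Level.Lift (c ⊔ ℓ)
    (poly C k ≡ sumP (map (λ x → scaleP (proj₁ x) (poly C (proj₂ x))) ws) ×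
     deg C k ≡ List.foldr ℕ._⊔_ 0 (map (λ x → deg C (proj₂ x)) ws))
  ShapeSound C k nonBinary     = Level.Lift (c ⊔ ℓ) (AllGates BinaryMul C → ⊥)

  shape-sound : ∀ {t} (C : Circuit t) k → ShapeSound C k (shape C k)
  shape-sound (var j ◁ C)   zero = Level.lift (tt , refl)
  shape-sound (const a ◁ C) zero = Level.lift (tt , refl)
  shape-sound (mul (a ∷ b ∷ []) ◁ C) zero = Level.lift
    ( (λ e → *P-congʳ (poly C a) (*P-identityʳ (poly C b)) e)
    , ≡.cong (deg C a ℕ.+_) (ℕP.+-identityʳ (deg C b)) , tt , tt)
  shape-sound (mul (a ∷ []) ◁ C)        zero = Level.lift (λ { (Level.lift () , _) })
  shape-sound (mul (a ∷ b ∷ _ ∷ _) ◁ C) zero = Level.lift (λ { (Level.lift () , _) })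
  shape-sound (add ws ◁ C) zero = Level.lift
    (≡.cong sumP (LP.map-∘ (toList ws)) , ≡.cong (List.foldr ℕ._⊔_ 0) (LP.map-∘ (toList ws)))
  shape-sound (g ◁ C) (suc k) with shape C k | shape-sound C k
  ... | input       | Level.lift p                 = Level.lift p
  ... | product a b | Level.lift (p , q , _ , _)   = Level.lift (p , q , tt , tt)
  ... | lincomb ws  | Level.lift (p , q)           = Level.lift
    (≡.trans p (≡.cong sumP (LP.map-∘ ws)) , ≡.trans q (≡.cong (List.foldr ℕ._⊔_ 0) (LP.map-∘ ws)))
  ... | nonBinary   | Level.lift p                 = Level.lift (λ { (_ , rest) → p rest })

  deg-positive : ∀ {t} (C : Circuit t) k → 1 ≤ deg C k
  deg-positive (var j ◁ C)                  zero = ℕP.≤-refl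
  deg-positive (const a ◁ C)                zero = ℕP.≤-refl
  deg-positive (mul (a ∷ cs) ◁ C)           zero = ℕP.≤-trans (deg-positive C a) (ℕP.m≤m+n _ _)
  deg-positive (add ((w , a) ∷ ws) ◁ C)     zero = ℕP.≤-trans (deg-positive C a) (ℕP.m≤m⊔n _ _)
  deg-positive (g ◁ C)                   (suc k) = deg-positive C k

  expand : ∀ {t} → Circuit t → Fin t → List (K × Fin t)
  expand (g ◁ C) (suc k) = map lift (expand C k)
  expand (add ws ◁ C) zero =
    concatMap (λ x → map (λ y → (proj₁ x * proj₁ y , suc (proj₂ y))) (expand C (proj₂ x))) (toList ws)
  expand (var j ◁ C)   zero = (1# , zero) ∷ []
  expand (const a ◁ C) zero = (1# , zero) ∷ []
  expand (mul cs ◁ C)  zero = (1# , zero) ∷ []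

  expansionTerm : ∀ {t} → Circuit t → Monomial → K × Fin t → K
  expansionTerm C e (a , g) = a * coeff (poly C g) e

  expand-sound : ∀ {t} (C : Circuit t) k e → coeff (poly C k) e ≈ Σl (expand C k) (expansionTerm C e)
  expand-sound (add ws ◁ C) zero e = begin
    coeff (sumP (map φ (toList ws))) e                        ≈⟨ coeff-sumP (map φ (toList ws)) e ⟩
    Σl (map φ (toList ws)) (λ p → coeff p e)                  ≡⟨ Σ-map φ (toList ws) _ ⟩
    Σl (toList ws) (λ x → coeff (φ x) e)
      ≈⟨ Σ-cong (toList ws) (λ x → coeff-scaleP (proj₁ x) (poly C (proj₂ x)) e) ⟩
    Σl (toList ws) (λ x → proj₁ x * coeff (poly C (proj₂ x)) e)
      ≈⟨ Σ-cong (toList ws) (λ x → *-cong ≈-refl (expand-sound C (proj₂ x) e)) ⟩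
    Σl (toList ws) (λ x → proj₁ x * Σl (expand C (proj₂ x)) (expansionTerm C e))
      ≈⟨ Σ-cong (toList ws) (λ x → ≈-trans (Σ-*ˡ (proj₁ x) (expand C (proj₂ x)) _)
                                           (Σ-cong (expand C (proj₂ x)) (λ y → ≈-sym (*-assoc _ _ _)))) ⟩
    Σl (toList ws) (λ x → Σl (expand C (proj₂ x)) (λ y → (proj₁ x * proj₁ y) * coeff (poly C (proj₂ y)) e))
      ≡⟨ Σ-cong≡ (toList ws) (λ x → ≡.sym (Σ-map (compose x) (expand C (proj₂ x)) (expansionTerm (add ws ◁ C) e))) ⟩
    Σl (toList ws) (λ x → Σl (map (compose x) (expand C (proj₂ x))) (expansionTerm (add ws ◁ C) e))
      ≈⟨ ≈-sym (Σ-concatMap (λ x → map (compose x) (expand C (proj₂ x))) (toList ws) _) ⟩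
    Σl (expand (add ws ◁ C) zero) (expansionTerm (add ws ◁ C) e) ∎
    where
    open import Relation.Binary.Reasoning.Setoid setoid
    φ : K × Fin _ → Poly
    φ x = scaleP (proj₁ x) (poly C (proj₂ x))
    compose : K × Fin _ → K × Fin _ → K × Fin (suc _)
    compose x y = (proj₁ x * proj₁ y , suc (proj₂ y))
  expand-sound (var j ◁ C)   zero e = ≈-sym (≈-trans (+-identityʳ _) (*-identityˡ _))
  expand-sound (const a ◁ C) zero e = ≈-sym (≈-trans (+-identityʳ _) (*-identityˡ _))
  expand-sound (mul cs ◁ C)  zero e = ≈-sym (≈-trans (+-identityʳ _) (*-identityˡ _))
  expand-sound (g ◁ C) (suc k) e =
    ≈-trans (expand-sound C k e) (reflexive (≡.sym (Σ-map lift (expand C k) (expansionTerm (g ◁ C) e))))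

  NotSum : ∀ {t} → Shape t → Set
  NotSum (lincomb _) = ⊥
  NotSum _           = ⊤

  NotSum-lift : ∀ {t} (v : Shape t) → NotSum v → NotSum (liftShape v)
  NotSum-lift input         _ = tt
  NotSum-lift (product a b) _ = tt
  NotSum-lift nonBinary     _ = tt

  Sign : K → Set ℓ
  Sign a = (a ≈ 1#) ⊎ (a ≈ - 1#)

  Sign-* : ∀ {a b} → Sign a → Sign b → Sign (a * b)
  Sign-* (inj₁ p) (inj₁ q) = inj₁ (≈-trans (*-cong p q) (*-identityˡ 1#))
  Sign-* (inj₁ p) (inj₂ q) = inj₂ (≈-trans (*-cong p q) (*-identityˡ _))
  Sign-* (inj₂ p) (inj₁ q) = inj₂ (≈-trans (*-cong p q) (*-identityʳ _))
  Sign-* (inj₂ p) (inj₂ q) = inj₁ (≈-trans (*-cong p q) (≈-trans (-1*x≈-x _) (-‿involutive 1#)))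

  ordinary-signs : ∀ {i} (ws : List⁺ (K × Fin i)) → OrdinaryAdd (add ws) → All (λ x → Sign (proj₁ x)) (toList ws)
  ordinary-signs ((a , k) ∷ (b , k′) ∷ []) (a≈1 , b≈±1) = inj₁ a≈1 ∷ b≈±1 ∷ []
  ordinary-signs (x ∷ [])         (Level.lift ())
  ordinary-signs (x ∷ y ∷ z ∷ zs) (Level.lift ())

  GoodTerm : ∀ {t} → Circuit t → Fin t → K × Fin t → Set ℓ
  GoodTerm C k (a , g) = Level.Lift ℓ (NotSum (shape C g) × deg C g ≤ deg C k) × (AllGates OrdinaryAdd C → Sign a)

  ⊔-∈ : ∀ {a} {A : Set a} (f : A → ℕ) (xs : List A) {x : A} → x ∈ xs → f x ≤ List.foldr ℕ._⊔_ 0 (map f xs)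
  ⊔-∈ f (y ∷ xs) (here refl) = ℕP.m≤m⊔n (f y) _
  ⊔-∈ f (y ∷ xs) (there x∈)  = ℕP.≤-trans (⊔-∈ f xs x∈) (ℕP.m≤n⊔m (f y) _)

  expand-good : ∀ {t} (C : Circuit t) k → All (GoodTerm C k) (expand C k)
  expand-good (add ws ◁ C) zero = AllP.concat⁺ (AllP.map⁺ (All.tabulate λ {x} x∈ →
    AllP.map⁺ (All.map (λ { {y} (Level.lift (ns , d≤) , sign) →
      Level.lift (NotSum-lift (shape C (proj₂ y)) ns , ℕP.≤-trans d≤ (⊔-∈ (λ z → deg C (proj₂ z)) (toList ws) x∈)) ,
      λ { (ord , rest) → Sign-* (All.lookup (ordinary-signs ws ord) x∈) (sign rest) } })
      (expand-good C (proj₂ x)))))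
  expand-good (var j ◁ C)   zero = (Level.lift (tt , ℕP.≤-refl) , λ _ → inj₁ ≈-refl) ∷ []
  expand-good (const a ◁ C) zero = (Level.lift (tt , ℕP.≤-refl) , λ _ → inj₁ ≈-refl) ∷ []
  expand-good (mul (a ∷ b ∷ []) ◁ C)        zero = (Level.lift (tt , ℕP.≤-refl) , λ _ → inj₁ ≈-refl) ∷ []
  expand-good (mul (a ∷ []) ◁ C)            zero = (Level.lift (tt , ℕP.≤-refl) , λ _ → inj₁ ≈-refl) ∷ []
  expand-good (mul (a ∷ b ∷ _ ∷ _) ◁ C)     zero = (Level.lift (tt , ℕP.≤-refl) , λ _ → inj₁ ≈-refl) ∷ []
  expand-good (g ◁ C) (suc k) = AllP.map⁺ (All.map (λ { {y} (Level.lift (ns , d≤) , sign) →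
    Level.lift (NotSum-lift (shape C (proj₂ y)) ns , d≤) , λ { (_ , rest) → sign rest } }) (expand-good C k))

module Stack {c ℓ : Level} (F : Field c ℓ) (n m : ℕ) (C : Circ.Circuit F n (suc m)) where

  open import Data.Fin using (Fin; zero; suc)
  open import Data.Vec using (Vec; []; _∷_; _∷ʳ_)
  open import Data.List as List using (List; []; _∷_; map; length)
  import Data.List.Properties as LP
  open import Data.List.Relation.Unary.All as All using (All; []; _∷_)
  import Data.List.Relation.Unary.All.Properties as AllP
  open import Data.Product using (_×_; _,_; proj₁; proj₂)
  open import Data.Sum using (inj₁; inj₂)
  open import Data.Unit using (⊤; tt)
  open import Data.Maybe using (Maybe; just; nothing)
  open import Relation.Nullary using (Dec; yes; no; contradiction)
  open import Relation.Binary.PropositionalEquality as ≡ using (_≡_; refl)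
  import Data.Nat.Properties as ℕP
  open import Data.Nat.ListAction using () renaming (sum to sumℕ)
  open import Data.Nat.Tactic.RingSolver using (solve-∀)
  import Data.Integer as ℤ

  open Field F hiding (zero) renaming (refl to ≈-refl; sym to ≈-sym; trans to ≈-trans; Carrier to K)
  open Circ F n
  open Polynomials F n
  open Gates F n

  t : ℕ
  t = suc m

  D : Fin t → ℕ
  D = deg C

  d : ℕ
  d = D zero

  δ : Fin t → ℕ
  δ g = ℕ.pred (D g)

  D≡suc-δ : ∀ g → D g ≡ suc (δ g)
  D≡suc-δ g = ≡.sym (ℕP.suc-pred (D g) {{ℕ.>-nonZero (deg-positive C g)}})

  -- Stacks of gates are stored in vectors of fixed length, padded at the
  -- end with the output gate `zero`, which is never pushed (it is not an
  -- input of any gate).  `stack v` reads the stack off the vector.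
  stack : ∀ {k} → Vec (Fin t) k → List (Fin t)
  stack []          = []
  stack (zero ∷ v)  = []
  stack (suc b ∷ v) = suc b ∷ stack v

  dropLast : ∀ {k} → Vec (Fin t) (suc k) → Vec (Fin t) k
  dropLast (x ∷ [])    = []
  dropLast (x ∷ y ∷ v) = x ∷ dropLast (y ∷ v)

  push : ∀ {k} → Fin t → Vec (Fin t) k → Vec (Fin t) k
  push x []      = []
  push x (y ∷ v) = x ∷ dropLast (y ∷ v)

  stack-pad : ∀ {k} (v : Vec (Fin t) k) → stack (v ∷ʳ zero) ≡ stack v
  stack-pad []          = refl
  stack-pad (zero ∷ v)  = refl
  stack-pad (suc b ∷ v) = ≡.cong (suc b ∷_) (stack-pad v)

  stack-dropLast : ∀ {k} (v : Vec (Fin t) (suc k)) → length (stack v) < suc k → stack (dropLast v) ≡ stack v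
  stack-dropLast (zero ∷ [])      _       = refl
  stack-dropLast (suc b ∷ [])     (s≤s ())
  stack-dropLast (zero ∷ y ∷ v)   _       = refl
  stack-dropLast (suc b ∷ y ∷ v) (s≤s p) = ≡.cong (suc b ∷_) (stack-dropLast (y ∷ v) p)

  stack-push : ∀ {k} b (v : Vec (Fin t) k) → length (stack v) < k → stack (push (suc b) v) ≡ suc b ∷ stack v
  stack-push b (x ∷ v) p = ≡.cong (suc b ∷_) (stack-dropLast (x ∷ v) p)

  -- A configuration g ∷ v: the gate g still to be computed, times the
  -- pending gates on the stack v.  A move leads to a configuration or
  -- (nothing) to the sink.
  Config : ℕ → Set
  Config k = Vec (Fin t) (suc k)

  Target : ℕ → Set
  Target k = Maybe (Config k)

  Move : ℕ → Set c
  Move k = Label t × Target k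

  lightHeavy : Fin t → Fin t → Fin t × Fin t
  lightHeavy a b with D a ℕ.≤? D b
  ... | yes _ = a , b
  ... | no _  = b , a

  -- Product moves need a free stack slot, which the invariant guarantees.
  onlyIf : ∀ {X : Set} {Y : Set c} → Dec X → List Y → List Y
  onlyIf (yes _) ys = ys
  onlyIf (no _)  ys = []

  expandFrom : ∀ {k} → Fin t → Vec (Fin t) k → List (Move k)
  expandFrom g v = map (λ x → cst (proj₁ x) , just (proj₂ x ∷ v)) (expand C g)

  pop : ∀ {k} → Fin t → Vec (Fin t) k → List (Move k)
  pop g []           = (inp g , nothing) ∷ []
  pop g (zero ∷ v)   = (inp g , nothing) ∷ []
  pop g (suc b ∷ v)  = (inp g , just (suc b ∷ (v ∷ʳ zero))) ∷ []

  movesFrom : ∀ {k} → Fin t → Vec (Fin t) k → Shape t → List (Move k)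
  movesFrom g v input         = pop g v
  movesFrom {k} g v (product a b) =
    onlyIf (length (stack v) ℕ.<? k) (expandFrom (proj₁ (lightHeavy a b)) (push (proj₂ (lightHeavy a b)) v))
  movesFrom g v (lincomb ws)  = expandFrom g v
  movesFrom g v nonBinary     = []

  moves : ∀ {k} → Config k → List (Move k)
  moves (g ∷ v) = movesFrom g v (shape C g)

  record LightHeavy (a b l h : Fin t) : Set (c ⊔ ℓ) where
    field
      light≤heavy : D l ≤ D h
      degree-sum  : D a ℕ.+ D b ≡ D l ℕ.+ D h
      same-poly   : (poly C a *P poly C b) ≈P (poly C l *P poly C h)
      heavy-inner : NotOutput a → NotOutput b → NotOutput h

  lightHeavy-sound : ∀ a b → LightHeavy a b (proj₁ (lightHeavy a b)) (proj₂ (lightHeavy a b))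
  lightHeavy-sound a b with D a ℕ.≤? D b
  ... | yes a≤b = record { light≤heavy = a≤b ; degree-sum = refl
                         ; same-poly = λ _ → ≈-refl ; heavy-inner = λ _ z → z }
  ... | no a≰b  = record { light≤heavy = ℕP.<⇒≤ (ℕP.≰⇒> a≰b) ; degree-sum = ℕP.+-comm (D a) (D b)
                         ; same-poly = *P-comm (poly C a) (poly C b) ; heavy-inner = λ z _ → z }

  product-degree : ∀ g a b h → ShapeSound C g (product a b) → proj₂ (lightHeavy a b) ≡ h →
    D g ≡ D (proj₁ (lightHeavy a b)) ℕ.+ D h
  product-degree g a b h (Level.lift (_ , Dg , _)) refl = ≡.trans Dg (LightHeavy.degree-sum (lightHeavy-sound a b))

  -- A pending gate b costs 2 + 3·δ b and the current gate g
  -- costs 1 + 3·δ g (+1 if it is an addition); every move lowers the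
  -- total, and the initial configuration has height ≤ 3d − 1.
  isSum : Shape t → ℕ
  isSum (lincomb _) = 1
  isSum _           = 0

  gateHeight : Fin t → ℕ
  gateHeight g = suc (3 ℕ.* δ g ℕ.+ isSum (shape C g))

  pendingHeight : Fin t → ℕ
  pendingHeight b = suc (suc (3 ℕ.* δ b))

  height : ∀ {k} → Config k → ℕ
  height (g ∷ v) = gateHeight g ℕ.+ sumℕ (map pendingHeight (stack v))

  heightT : ∀ {k} → Target k → ℕ
  heightT nothing  = 0
  heightT (just v) = height v

  gateHeight≤pendingHeight : ∀ g → gateHeight g ≤ pendingHeight g
  gateHeight≤pendingHeight g = s≤s (ℕP.≤-trans (ℕP.+-monoʳ-≤ (3 ℕ.* δ g) (isSum≤1 (shape C g)))
                                               (ℕP.≤-reflexive (ℕP.+-comm (3 ℕ.* δ g) 1)))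
    where
    isSum≤1 : ∀ v → isSum v ≤ 1
    isSum≤1 input         = z≤n
    isSum≤1 (product _ _) = z≤n
    isSum≤1 (lincomb _)   = ℕP.≤-refl
    isSum≤1 nonBinary     = z≤n

  gateHeight-NotSum : ∀ g → NotSum (shape C g) → gateHeight g ≡ suc (3 ℕ.* δ g)
  gateHeight-NotSum g ns with shape C g
  ... | input       = ≡.cong suc (ℕP.+-identityʳ _)
  ... | product _ _ = ≡.cong suc (ℕP.+-identityʳ _)
  ... | nonBinary   = ≡.cong suc (ℕP.+-identityʳ _)

  gateHeight-shape : ∀ g {v} → shape C g ≡ v → gateHeight g ≡ suc (3 ℕ.* δ g ℕ.+ isSum v)
  gateHeight-shape g eq = ≡.cong (λ v → suc (3 ℕ.* δ g ℕ.+ isSum v)) eq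

  δ-product : ∀ g l h → D g ≡ D l ℕ.+ D h → δ g ≡ suc (δ l ℕ.+ δ h)
  δ-product g l h eq = ≡.cong ℕ.pred (begin
    D g                       ≡⟨ eq ⟩
    D l ℕ.+ D h               ≡⟨ ≡.cong₂ ℕ._+_ (D≡suc-δ l) (D≡suc-δ h) ⟩
    suc (δ l) ℕ.+ suc (δ h)   ≡⟨ ≡.cong suc (ℕP.+-suc (δ l) (δ h)) ⟩
    suc (suc (δ l ℕ.+ δ h))   ∎)
    where open ≡.≡-Reasoning

  -- The arithmetic of a product move: a new current gate of δ ≤ x and a
  -- new pending gate of δ = y replace a gate of δ = 1 + x + y.
  product-step : ∀ x y z σ → z ≤ x →
    suc (3 ℕ.* z) ℕ.+ (suc (suc (3 ℕ.* y)) ℕ.+ σ) < suc (3 ℕ.* suc (x ℕ.+ y) ℕ.+ 0) ℕ.+ σ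
  product-step x y z σ z≤x = begin-strict
    suc (3 ℕ.* z) ℕ.+ (suc (suc (3 ℕ.* y)) ℕ.+ σ)
      ≤⟨ ℕP.+-monoˡ-≤ _ (s≤s (ℕP.*-monoʳ-≤ 3 z≤x)) ⟩
    suc (3 ℕ.* x) ℕ.+ (suc (suc (3 ℕ.* y)) ℕ.+ σ)
      <⟨ ℕP.n<1+n _ ⟩
    suc (suc (3 ℕ.* x) ℕ.+ (suc (suc (3 ℕ.* y)) ℕ.+ σ))
      ≡⟨ arith x y σ ⟩
    suc (3 ℕ.* suc (x ℕ.+ y) ℕ.+ 0) ℕ.+ σ ∎
    where
    open ℕP.≤-Reasoning
    arith : ∀ x y σ → suc (suc (3 ℕ.* x) ℕ.+ (suc (suc (3 ℕ.* y)) ℕ.+ σ)) ≡ suc (3 ℕ.* suc (x ℕ.+ y) ℕ.+ 0) ℕ.+ σ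
    arith = solve-∀

  Sign⇒small : ∀ {a} → Sign a → SmallIntConst {t = t} (2 ^ t) (cst a)
  Sign⇒small (inj₁ a≈1)  = ℤ.+ 1 , ℕP.m^n>0 2 t , Level.lift (≈-trans a≈1 (≈-sym (+-identityʳ 1#)))
  Sign⇒small (inj₂ a≈-1) = ℤ.-[1+ 0 ] , ℕP.m^n>0 2 t , Level.lift (≈-trans a≈-1 (-‿cong (≈-sym (+-identityʳ 1#))))

  GoodMove : ∀ {k} → Config k → Move k → Set (c ⊔ ℓ)
  GoodMove v (l , tg) = Level.Lift (c ⊔ ℓ) (heightT tg < height v × ValidLabel C l) ×
                        (AllGates OrdinaryAdd C → SmallIntConst (2 ^ t) l)

  expand-good-moves : ∀ {k} (u : Config k) l (v : Vec (Fin t) k) →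
    (∀ h → NotSum (shape C h) → D h ≤ D l → gateHeight h ℕ.+ sumℕ (map pendingHeight (stack v)) < height u) →
    All (GoodMove u) (expandFrom l v)
  expand-good-moves u l v lower = AllP.map⁺ (All.map
    (λ { {_ , h} (Level.lift (ns , D≤) , sign) → Level.lift (lower h ns D≤ , tt) , λ ord → Sign⇒small (sign ord) })
    (expand-good C l))

  pop-lower : ∀ {k} g b (v : Vec (Fin t) k) → height (suc b ∷ (v ∷ʳ zero)) < height (g ∷ suc b ∷ v)
  pop-lower g b v = begin-strict
    gateHeight (suc b) ℕ.+ sumℕ (map pendingHeight (stack (v ∷ʳ zero)))
      ≡⟨ ≡.cong (λ S → gateHeight (suc b) ℕ.+ sumℕ (map pendingHeight S)) (stack-pad v) ⟩
    gateHeight (suc b) ℕ.+ σ                        ≤⟨ ℕP.+-monoˡ-≤ σ (gateHeight≤pendingHeight (suc b)) ⟩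
    pendingHeight (suc b) ℕ.+ σ                     <⟨ s≤s (ℕP.m≤n+m _ _) ⟩
    gateHeight g ℕ.+ (pendingHeight (suc b) ℕ.+ σ)  ∎
    where
    open ℕP.≤-Reasoning
    σ = sumℕ (map pendingHeight (stack v))

  sum-lower : ∀ {k} g ws (v : Vec (Fin t) k) → shape C g ≡ lincomb ws →
    ∀ h → NotSum (shape C h) → D h ≤ D g → gateHeight h ℕ.+ sumℕ (map pendingHeight (stack v)) < height (g ∷ v)
  sum-lower g ws v shape≡ h ns D≤ = begin-strict
    gateHeight h ℕ.+ σ                ≡⟨ ≡.cong (ℕ._+ σ) (gateHeight-NotSum h ns) ⟩
    suc (3 ℕ.* δ h) ℕ.+ σ             ≤⟨ ℕP.+-monoˡ-≤ σ (s≤s (ℕP.*-monoʳ-≤ 3 (ℕP.pred-mono-≤ D≤))) ⟩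
    suc (3 ℕ.* δ g) ℕ.+ σ             <⟨ ℕP.+-monoˡ-< σ (s≤s (ℕP.≤-reflexive (ℕP.+-comm 1 _))) ⟩
    suc (3 ℕ.* δ g ℕ.+ 1) ℕ.+ σ       ≡⟨ ≡.cong (ℕ._+ σ) (gateHeight-shape g shape≡) ⟨
    height (g ∷ v)                    ∎
    where
    open ℕP.≤-Reasoning
    σ = sumℕ (map pendingHeight (stack v))

  product-lower : ∀ {k} g a b h′ (v : Vec (Fin t) k) → shape C g ≡ product a b → ShapeSound C g (product a b) →
    proj₂ (lightHeavy a b) ≡ suc h′ → length (stack v) < k →
    ∀ h → NotSum (shape C h) → D h ≤ D (proj₁ (lightHeavy a b)) →
    gateHeight h ℕ.+ sumℕ (map pendingHeight (stack (push (suc h′) v))) < height (g ∷ v)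
  product-lower g a b h′ v shape≡ sound heavy≡ room h ns D≤ = begin-strict
    gateHeight h ℕ.+ sumℕ (map pendingHeight (stack (push (suc h′) v)))
      ≡⟨ ≡.cong₂ (λ x S → x ℕ.+ sumℕ (map pendingHeight S)) (gateHeight-NotSum h ns) (stack-push h′ v room) ⟩
    suc (3 ℕ.* δ h) ℕ.+ (pendingHeight (suc h′) ℕ.+ σ)
      <⟨ product-step (δ l) (δ (suc h′)) (δ h) σ (ℕP.pred-mono-≤ D≤) ⟩
    suc (3 ℕ.* suc (δ l ℕ.+ δ (suc h′)) ℕ.+ 0) ℕ.+ σ
      ≡⟨ ≡.cong (λ x → suc (3 ℕ.* x ℕ.+ 0) ℕ.+ σ)
                (δ-product g l (suc h′) (product-degree g a b (suc h′) sound heavy≡)) ⟨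
    suc (3 ℕ.* δ g ℕ.+ 0) ℕ.+ σ       ≡⟨ ≡.cong (ℕ._+ σ) (gateHeight-shape g shape≡) ⟨
    height (g ∷ v)                    ∎
    where
    open ℕP.≤-Reasoning
    l = proj₁ (lightHeavy a b)
    σ = sumℕ (map pendingHeight (stack v))

  moves-good : ∀ {k} (u : Config k) → All (GoodMove u) (moves u)
  moves-good (g ∷ v) with shape C g in shape≡ | shape-sound C g
  moves-good (g ∷ [])        | input | Level.lift (isIn , _) = (Level.lift (s≤s z≤n , isIn) , λ _ → Level.lift tt) ∷ []
  moves-good (g ∷ zero ∷ v)  | input | Level.lift (isIn , _) = (Level.lift (s≤s z≤n , isIn) , λ _ → Level.lift tt) ∷ []
  moves-good (g ∷ suc b ∷ v) | input | Level.lift (isIn , _) =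
    (Level.lift (pop-lower g b v , isIn) , λ _ → Level.lift tt) ∷ []
  moves-good (g ∷ v) | lincomb ws | _ = expand-good-moves (g ∷ v) g v (sum-lower g ws v shape≡)
  moves-good {k} (g ∷ v) | product a b | sound@(Level.lift (_ , _ , na , nb)) with length (stack v) ℕ.<? k
  ... | no _     = []
  ... | yes room with lightHeavy-sound a b | proj₂ (lightHeavy a b) in heavy≡
  ...   | lh | zero   = contradiction (≡.subst NotOutput heavy≡ (LightHeavy.heavy-inner lh na nb)) (λ ())
  ...   | lh | suc h′ = expand-good-moves (g ∷ v) (proj₁ (lightHeavy a b)) (push (suc h′) v)
                          (product-lower g a b h′ v shape≡ sound heavy≡ room)
  moves-good (g ∷ v) | nonBinary | _ = []

  -- Since a product gate has degree ≥ 2, it guarantees a free stack slot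
  -- when the vectors have length K + 1 with d < 2^(K+1).
  StackOK : List (Fin t) → Set
  StackOK []      = ⊤
  StackOK (b ∷ S) = (D b ℕ.* 2 ^ length S ≤ d) × StackOK S

  Invariant : ∀ {k} → Config k → Set
  Invariant (g ∷ v) = (D g ℕ.* 2 ^ length (stack v) ≤ d) × StackOK (stack v)

  InvariantT : ∀ {k} → Target k → Set
  InvariantT nothing  = ⊤
  InvariantT (just u) = Invariant u

  stack-not-full : ∀ {k} g (v : Vec (Fin t) k) → d < 2 ^ suc k → Invariant (g ∷ v) → 2 ≤ D g →
    length (stack v) < k
  stack-not-full {k} g v d< (bound , _) 2≤D = ℕP.≰⇒> λ k≤L → ℕP.<-irrefl refl (begin-strict
    d                                      <⟨ d< ⟩
    2 ℕ.* 2 ^ k                            ≤⟨ ℕP.*-monoʳ-≤ 2 (ℕP.^-monoʳ-≤ 2 k≤L) ⟩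
    2 ℕ.* 2 ^ length (stack v)             ≤⟨ ℕP.*-monoˡ-≤ (2 ^ length (stack v)) 2≤D ⟩
    D g ℕ.* 2 ^ length (stack v)           ≤⟨ bound ⟩
    d                                      ∎)
    where open ℕP.≤-Reasoning

  product-degree≥2 : ∀ g a b → ShapeSound C g (product a b) → 2 ≤ D g
  product-degree≥2 g a b (Level.lift (_ , Dg , _)) =
    ℕP.≤-trans (ℕP.+-mono-≤ (deg-positive C a) (deg-positive C b)) (ℕP.≤-reflexive (≡.sym Dg))

  expand-preserves : ∀ {k} l (v : Vec (Fin t) k) → (∀ h → D h ≤ D l → Invariant (h ∷ v)) →
    All (λ mv → InvariantT (proj₂ mv)) (expandFrom l v)
  expand-preserves l v inv = AllP.map⁺ (All.map
    (λ { {_ , h} (Level.lift (_ , D≤) , _) → inv h D≤ }) (expand-good C l))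

  -- After a product move, the new current gate has at most half the
  -- degree of g and the pushed factor at most the degree of g.
  product-preserves : ∀ {k} g a b h′ (v : Vec (Fin t) k) → ShapeSound C g (product a b) →
    proj₂ (lightHeavy a b) ≡ suc h′ → length (stack v) < k → Invariant (g ∷ v) →
    ∀ h → D h ≤ D (proj₁ (lightHeavy a b)) → Invariant (h ∷ push (suc h′) v)
  product-preserves g a b h′ v sound heavy≡ room (bound , ok) h D≤ =
    ≡.subst (λ S → (D h ℕ.* 2 ^ length S ≤ d) × StackOK S) (≡.sym (stack-push h′ v room))
      (current , pending , ok)
    where
    l  = proj₁ (lightHeavy a b)
    L  = length (stack v)
    Dg : D g ≡ D l ℕ.+ D (suc h′)
    Dg = product-degree g a b (suc h′) sound heavy≡
    l≤h : D l ≤ D (suc h′)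
    l≤h = ≡.subst (λ x → D l ≤ D x) heavy≡ (LightHeavy.light≤heavy (lightHeavy-sound a b))
    current : D h ℕ.* 2 ^ suc L ≤ d
    current = begin
      D h ℕ.* (2 ℕ.* 2 ^ L)          ≡⟨ double (D h) (2 ^ L) ⟩
      (D h ℕ.+ D h) ℕ.* 2 ^ L        ≤⟨ ℕP.*-monoˡ-≤ (2 ^ L) (ℕP.+-mono-≤ D≤ (ℕP.≤-trans D≤ l≤h)) ⟩
      (D l ℕ.+ D (suc h′)) ℕ.* 2 ^ L ≡⟨ ≡.cong (ℕ._* 2 ^ L) Dg ⟨
      D g ℕ.* 2 ^ L                  ≤⟨ bound ⟩
      d                              ∎
      where
      open ℕP.≤-Reasoning
      double : ∀ x y → x ℕ.* (2 ℕ.* y) ≡ (x ℕ.+ x) ℕ.* y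
      double = solve-∀
    pending : D (suc h′) ℕ.* 2 ^ L ≤ d
    pending = ℕP.≤-trans (ℕP.*-monoˡ-≤ (2 ^ L) (ℕP.≤-trans (ℕP.m≤n+m _ (D l)) (ℕP.≤-reflexive (≡.sym Dg)))) bound

  moves-preserve : ∀ {k} (u : Config k) → Invariant u → All (λ mv → InvariantT (proj₂ mv)) (moves u)
  moves-preserve (g ∷ v) inv with shape C g | shape-sound C g
  moves-preserve (g ∷ [])        inv | input | _ = tt ∷ []
  moves-preserve (g ∷ zero ∷ v)  inv | input | _ = tt ∷ []
  moves-preserve (g ∷ suc b ∷ v) inv | input | _ =
    ≡.subst (λ S → (D (suc b) ℕ.* 2 ^ length S ≤ d) × StackOK S) (≡.sym (stack-pad v)) (proj₂ inv) ∷ []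
  moves-preserve (g ∷ v) (bound , ok) | lincomb ws | _ = expand-preserves g v λ h D≤ →
    ℕP.≤-trans (ℕP.*-monoˡ-≤ (2 ^ length (stack v)) D≤) bound , ok
  moves-preserve {k} (g ∷ v) inv | product a b | sound@(Level.lift (_ , _ , na , nb))
    with length (stack v) ℕ.<? k
  ... | no _     = []
  ... | yes room with lightHeavy-sound a b | proj₂ (lightHeavy a b) in heavy≡
  ...   | lh | zero   = contradiction (≡.subst NotOutput heavy≡ (LightHeavy.heavy-inner lh na nb)) (λ ())
  ...   | lh | suc h′ = expand-preserves (proj₁ (lightHeavy a b)) (push (suc h′) v)
                          (product-preserves g a b h′ v sound heavy≡ room inv)
  moves-preserve (g ∷ v) inv | nonBinary | _ = []

  -- Each configuration is the sum over its moves of label × meaning of the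
  -- target, which is what makes the program compute the output.
  stackPoly : List (Fin t) → Poly
  stackPoly S = prodP (map (poly C) S)

  meaning : ∀ {k} → Config k → Poly
  meaning (g ∷ v) = poly C g *P stackPoly (stack v)

  meaningT : ∀ {k} → Target k → Poly
  meaningT nothing  = constP 1#
  meaningT (just u) = meaning u

  movePoly : ∀ {k} → Move k → Poly
  movePoly (l , tg) = labelPoly C l *P meaningT tg

  expand-*P : ∀ g Q → (poly C g *P Q) ≈P sumP (map (λ x → constP (proj₁ x) *P (poly C (proj₂ x) *P Q)) (expand C g))
  expand-*P g Q = begin
    poly C g *P Q                              ≈⟨ *P-congˡ {poly C g} {sumP (map scaled X)} Q expanded ⟩
    sumP (map scaled X) *P Q                   ≈⟨ sumP-*P (map scaled X) Q ⟩
    sumP (map (_*P Q) (map scaled X))          ≡⟨ ≡.cong sumP (LP.map-∘ X) ⟨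
    sumP (map (λ x → scaled x *P Q) X)         ≈⟨ sumP-cong X (λ x → *P-assoc (constP (proj₁ x)) (poly C (proj₂ x)) Q) ⟩
    sumP (map (λ x → constP (proj₁ x) *P (poly C (proj₂ x) *P Q)) X) ∎
    where
    open import Relation.Binary.Reasoning.Setoid ≈P-setoid
    X = expand C g
    scaled : K × Fin t → Poly
    scaled x = constP (proj₁ x) *P poly C (proj₂ x)
    expanded : ∀ e → coeff (poly C g) e ≈ coeff (sumP (map scaled X)) e
    expanded e = ≈-trans (expand-sound C g e)
      (≈-trans (Σ-cong X (λ x → ≈-sym (coeff-constP-*P (proj₁ x) (poly C (proj₂ x)) e)))
        (≈-trans (reflexive (≡.sym (Σ-map scaled X (λ p → coeff p e)))) (≈-sym (coeff-sumP (map scaled X) e))))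

  expandFrom-local : ∀ {k} l (v : Vec (Fin t) k) →
    (poly C l *P stackPoly (stack v)) ≈P sumP (map movePoly (expandFrom l v))
  expandFrom-local l v e = ≈-trans (expand-*P l (stackPoly (stack v)) e)
    (reflexive (≡.cong (λ ps → coeff (sumP ps) e) (LP.map-∘ (expand C l))))

  single-move : ∀ p → p ≈P sumP (p ∷ [])
  single-move p e = ≈-sym (+P-identityʳ p e)

  moves-local : ∀ {k} (u : Config k) → d < 2 ^ suc k → AllGates BinaryMul C → Invariant u →
    meaning u ≈P sumP (map movePoly (moves u))
  moves-local (g ∷ v) d< binary inv with shape C g | shape-sound C g
  moves-local (g ∷ [])        d< binary inv | input | _ = single-move (poly C g *P constP 1#)
  moves-local (g ∷ zero ∷ v)  d< binary inv | input | _ = single-move (poly C g *P constP 1#)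
  moves-local (g ∷ suc b ∷ v) d< binary inv | input | _ rewrite stack-pad v =
    single-move (poly C g *P (poly C (suc b) *P stackPoly (stack v)))
  moves-local (g ∷ v) d< binary inv | lincomb ws | _ = expandFrom-local g v
  moves-local {k} (g ∷ v) d< binary inv | product a b | sound@(Level.lift (g≈ab , _ , na , nb))
    with length (stack v) ℕ.<? k
  ... | no full  = contradiction (stack-not-full g v d< inv (product-degree≥2 g a b sound)) full
  ... | yes room with lightHeavy-sound a b | proj₂ (lightHeavy a b) in heavy≡
  ...   | lh | zero   = contradiction (≡.subst NotOutput heavy≡ (LightHeavy.heavy-inner lh na nb)) (λ ())
  ...   | lh | suc h′ = begin
    poly C g *P S                              ≈⟨ *P-congˡ {poly C g} {poly C a *P poly C b} S g≈ab ⟩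
    (poly C a *P poly C b) *P S                ≈⟨ *P-congˡ {poly C a *P poly C b} {poly C l *P poly C h} S lh≈ ⟩
    (poly C l *P poly C h) *P S                ≈⟨ *P-assoc (poly C l) (poly C h) S ⟩
    poly C l *P (poly C h *P S)                ≡⟨ ≡.cong (λ T → poly C l *P stackPoly T) (stack-push h′ v room) ⟨
    poly C l *P stackPoly (stack (push h v))   ≈⟨ expandFrom-local l (push h v) ⟩
    sumP (map movePoly (expandFrom l (push h v))) ∎
    where
    open import Relation.Binary.Reasoning.Setoid ≈P-setoid
    l = proj₁ (lightHeavy a b)
    h = suc h′
    S = stackPoly (stack v)
    lh≈ : (poly C a *P poly C b) ≈P (poly C l *P poly C h)
    lh≈ = ≡.subst (λ x → (poly C a *P poly C b) ≈P (poly C l *P poly C x)) heavy≡ (LightHeavy.same-poly lh)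
  moves-local (g ∷ v) d< binary inv | nonBinary | Level.lift notBinary = contradiction binary notBinary

open import Data.Nat using (_*_; _∸_)
import Data.Nat.Properties as ℕP
open import Data.Fin as Fin using (Fin; zero; suc)
import Data.Fin.Properties as FinP
open import Data.Vec as Vec using (Vec; []; _∷_)
open import Data.List as List using (List; []; _∷_; map)
import Data.List.Properties as LP
open import Data.List.Relation.Unary.All as All using (All; []; _∷_)
import Data.List.Relation.Unary.All.Properties as AllP
open import Data.Product using (Σ; _×_; _,_; proj₁; proj₂)
open import Data.Maybe using (just; nothing)
open import Relation.Nullary using (yes; no; contradiction)
open import Relation.Binary.PropositionalEquality as ≡ using (_≡_; refl)
open import Data.Nat.ListAction using () renaming (sum to sumℕ)
open import Data.Nat.Tactic.RingSolver using (solve-∀)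

-- Every d ≥ 1 satisfies 2^K ≤ d < 2^(K+1) for some K, found by searching
-- downwards from the bound d < 2^d.
n<2^n : ∀ n → n < 2 ^ n
n<2^n zero    = s≤s z≤n
n<2^n (suc n) = ℕP.+-mono-≤ (ℕP.m^n>0 2 n) (ℕP.≤-trans (n<2^n n) (ℕP.≤-reflexive (≡.sym (ℕP.+-identityʳ _))))

binary-magnitude : ∀ d → 1 ≤ d → Σ ℕ λ K → (2 ^ K ≤ d) × (d < 2 ^ suc K)
binary-magnitude d 1≤d = search d (n<2^n d)
  where
  search : ∀ j → d < 2 ^ j → Σ ℕ λ K → (2 ^ K ≤ d) × (d < 2 ^ suc K)
  search zero    d<1 = contradiction 1≤d (ℕP.<⇒≱ d<1)
  search (suc j) d<  with d ℕ.<? 2 ^ j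
  ... | yes d<2^j = search j d<2^j
  ... | no  d≮2^j = j , ℕP.≮⇒≥ d≮2^j , d<

2^-cancel-≤ : ∀ a b → 2 ^ a ≤ 2 ^ b → a ≤ b
2^-cancel-≤ a b 2^a≤2^b = ℕP.≮⇒≥ λ b<a → ℕP.<⇒≱ (ℕP.^-monoʳ-< 2 (s≤s (s≤s z≤n)) b<a) 2^a≤2^b

-- If 2^(K+1) ≤ b then t^(K+1) ≤ t^(log₂ b): for a rational exponent
-- p/q ≥ log₂ b we get 2^((K+1)q) ≤ b^q ≤ 2^p, so (K+1)q ≤ p.
^log₂-bound : ∀ m K b → 2 ^ suc K ≤ b → suc m ^ suc K ≤ suc m ^log₂ b
^log₂-bound m K b 2^K+1≤b p q _ b^q≤2^p = begin
  (suc m ^ suc K) ^ q      ≡⟨ ℕP.^-*-assoc (suc m) (suc K) q ⟩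
  suc m ^ (suc K * q)      ≤⟨ ℕP.^-monoʳ-≤ (suc m) (2^-cancel-≤ (suc K * q) p 2^Kq≤2^p) ⟩
  suc m ^ p                ∎
  where
  open ℕP.≤-Reasoning
  2^Kq≤2^p : 2 ^ (suc K * q) ≤ 2 ^ p
  2^Kq≤2^p = begin
    2 ^ (suc K * q)        ≡⟨ ℕP.^-*-assoc 2 (suc K) q ⟨
    (2 ^ suc K) ^ q        ≤⟨ ℕP.^-monoˡ-≤ q 2^K+1≤b ⟩
    b ^ q                  ≤⟨ b^q≤2^p ⟩
    2 ^ p                  ∎

-- The branching program for a circuit C with t = m + 1 gates whose formal
-- degree satisfies d < 2^(K+1): its vertices are the sink and the
-- configurations with stacks of at most K gates, that is 1 + t^(K+1).
module Construction {c ℓ : Level} (F : Field c ℓ) (n m : ℕ) (C : Circ.Circuit F n (suc m))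
  (K : ℕ) (d<2^K+1 : Circ.formalDegree F n C < 2 ^ suc K)
  (binary : Circ.AllGates F n (Circ.BinaryMul F n) C) where

  open Field F using (1#; reflexive) renaming (trans to ≈-trans)
  open Circ F n
  open Polynomials F n
  open Programs F n
  open Gates F n
  open Stack F n m C

  -- Vectors in Fin t ^ k, numbered in base t.
  decode : ∀ k → Fin (t ^ k) → Vec (Fin t) k
  decode zero    _ = []
  decode (suc k) j = proj₁ (Fin.remQuot {t} (t ^ k) j) ∷ decode k (proj₂ (Fin.remQuot {t} (t ^ k) j))

  encode : ∀ {k} → Vec (Fin t) k → Fin (t ^ k)
  encode []      = zero
  encode (a ∷ v) = Fin.combine a (encode v)

  decode-encode : ∀ {k} (v : Vec (Fin t) k) → decode k (encode v) ≡ v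
  decode-encode []              = refl
  decode-encode {suc k} (a ∷ v) =
    ≡.trans (≡.cong (λ r → proj₁ r ∷ decode k (proj₂ r)) (FinP.remQuot-combine {t} {t ^ k} a (encode v)))
            (≡.cong (a ∷_) (decode-encode v))

  N : ℕ
  N = suc (t ^ suc K)

  vertex : Target K → Fin N
  vertex nothing  = zero
  vertex (just v) = suc (encode v)

  target : Fin N → Target K
  target zero    = nothing
  target (suc j) = just (decode (suc K) j)

  target-vertex : ∀ tg → target (vertex tg) ≡ tg
  target-vertex nothing  = refl
  target-vertex (just v) = ≡.cong just (decode-encode v)

  targetMoves : Target K → List (Move K)
  targetMoves nothing  = []
  targetMoves (just v) = moves v

  Out : Fin N → List (Label t × Fin N)
  Out u = map (λ mv → proj₁ mv , vertex (proj₂ mv)) (targetMoves (target u))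

  vertexHeight : Fin N → ℕ
  vertexHeight u = heightT (target u)

  labels-Out : ∀ {r} (P : Label t → Set r) → (∀ v → All (λ mv → P (proj₁ mv)) (moves v)) →
    ∀ u → All (λ x → P (proj₁ x)) (Out u)
  labels-Out P all-moves u with target u
  ... | nothing = []
  ... | just v  = AllP.map⁺ (all-moves v)

  descend : ∀ u → All (λ x → vertexHeight (proj₂ x) < vertexHeight u) (Out u)
  descend u with target u
  ... | nothing = []
  ... | just v  = AllP.map⁺ (All.map (λ { {l , tg} (Level.lift (lower , _) , _) →
                    ≡.subst (λ x → heightT x < height v) (≡.sym (target-vertex tg)) lower }) (moves-good v))

  initial : Config K
  initial = zero ∷ Vec.replicate K zero

  module Graph = FromGraph (Label t) (labelPoly C) N vertexHeight Out descend (vertex (just initial)) zero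
  open Graph using (atSink; depth; all-labels; module Solution)
  open Graph using (program) public

  -- The invariant holds initially and is preserved by moves; on it the
  -- local equations hold, so the program computes the meaning of the
  -- initial configuration, which is the output polynomial.
  invariant : Fin N → Set
  invariant u = InvariantT (target u)

  invariant-closed : ∀ u → invariant u → All (λ x → invariant (proj₂ x)) (Out u)
  invariant-closed u with target u
  ... | nothing = λ _ → []
  ... | just v  = λ inv → AllP.map⁺ (All.map (λ {mv} i → ≡.subst InvariantT (≡.sym (target-vertex (proj₂ mv))) i)
                                             (moves-preserve v inv))

  meaningV : Fin N → Poly
  meaningV u = meaningT (target u)

  local : ∀ u → invariant u →
    meaningV u ≈P (atSink u +P sumP (map (λ x → labelPoly C (proj₁ x) *P meaningV (proj₂ x)) (Out u)))
  local zero    _   = single-move (constP 1#)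
  local (suc j) inv = begin
    meaning v                                      ≈⟨ moves-local v d<2^K+1 binary inv ⟩
    sumP (map movePoly (moves v))                  ≡⟨ ≡.cong sumP (LP.map-cong via-vertex (moves v)) ⟩
    sumP (map (λ mv → labelPoly C (proj₁ mv) *P meaningV (vertex (proj₂ mv))) (moves v))
                                                   ≡⟨ ≡.cong sumP (LP.map-∘ (moves v)) ⟩
    sumP (map (λ x → labelPoly C (proj₁ x) *P meaningV (proj₂ x)) (Out (suc j))) ∎
    where
    open import Relation.Binary.Reasoning.Setoid ≈P-setoid
    v = decode (suc K) j
    via-vertex : ∀ mv → movePoly mv ≡ labelPoly C (proj₁ mv) *P meaningV (vertex (proj₂ mv))
    via-vertex (l , tg) = ≡.cong (λ x → labelPoly C l *P meaningT x) (≡.sym (target-vertex tg))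

  stack-empty : ∀ k → stack (Vec.replicate k zero) ≡ []
  stack-empty zero    = refl
  stack-empty (suc k) = refl

  initial-vertex : target (vertex (just initial)) ≡ just initial
  initial-vertex = target-vertex (just initial)

  initial-invariant : invariant (vertex (just initial))
  initial-invariant = ≡.subst InvariantT (≡.sym initial-vertex)
    (≡.subst (λ S → (D zero * 2 ^ List.length S ≤ d) × StackOK S) (≡.sym (stack-empty K))
             (ℕP.≤-reflexive (ℕP.*-identityʳ d) , _))

  computes-output : ABP.value program (labelPoly C) ≈P output C
  computes-output e = ≈-trans (Solution.value-solution invariant meaningV invariant-closed local initial-invariant e)
    (≈-trans (reflexive (≡.cong (λ tg → coeff (meaningT tg) e) initial-vertex))
      (≈-trans (reflexive (≡.cong (λ S → coeff (poly C zero *P stackPoly S) e) (stack-empty K)))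
               (*P-identityʳ (poly C zero) e)))

  depth-bound : ABP.DepthAtMost program (3 * d ∸ 1)
  depth-bound = depth (3 * d ∸ 1) (begin
    vertexHeight (vertex (just initial))  ≡⟨ ≡.cong heightT initial-vertex ⟩
    height initial                        ≡⟨ ≡.cong (λ S → gateHeight zero ℕ.+ sumℕ (map pendingHeight S)) (stack-empty K) ⟩
    gateHeight zero ℕ.+ 0                 ≡⟨ ℕP.+-identityʳ _ ⟩
    gateHeight zero                       ≤⟨ gateHeight≤pendingHeight zero ⟩
    pendingHeight zero                    ≡⟨ ≡.cong (_∸ 1) (thrice (δ zero)) ⟨
    3 * suc (δ zero) ∸ 1                  ≡⟨ ≡.cong (λ x → 3 * x ∸ 1) (D≡suc-δ zero) ⟨
    3 * d ∸ 1                             ∎)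
    where
    open ℕP.≤-Reasoning
    thrice : ∀ x → 3 * suc x ≡ suc (suc (suc (3 * x)))
    thrice = solve-∀

  valid-labels : All (λ ed → ValidLabel C (Edge.label ed)) (ABP.edges program)
  valid-labels = all-labels (ValidLabel C) (labels-Out (ValidLabel C) λ v →
    All.map (λ { (Level.lift (_ , valid) , _) → valid }) (moves-good v))

  small-constants : AllGates OrdinaryAdd C → All (λ ed → SmallIntConst (2 ^ t) (Edge.label ed)) (ABP.edges program)
  small-constants ordinary = all-labels (SmallIntConst (2 ^ t)) (labels-Out (SmallIntConst (2 ^ t)) λ v →
    All.map (λ { (_ , small) → small ordinary }) (moves-good v))

-- The theorem: with K from 2^K ≤ d < 2^(K+1) the construction has
-- 1 + t^(K+1) ≤ 1 + t^(log₂ 2d) vertices.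
theorem2 : ∀ {c ℓ} (F : Field c ℓ) (n m : ℕ) (C : Circ.Circuit F n (suc m)) →
    let open Circ F n
        t = suc m
        d = formalDegree C
    in AllGates BinaryMul C →
       InputFanOut≤1 C →
       Σ (ABP (Label t)) λ G →
         (ABP.value G (labelPoly C) ≈P output C)
         × (ABP.size G ∸ 1 ≤ t ^log₂ (2 * d))
         × ABP.DepthAtMost G (3 * d ∸ 1)
         × All (λ e → ValidLabel C (Edge.label e)) (ABP.edges G)
         × (AllGates OrdinaryAdd C →
              All (λ e → SmallIntConst (2 ^ t) (Edge.label e)) (ABP.edges G))
theorem2 F n m C binary _
  with binary-magnitude (Circ.formalDegree F n C) (Gates.deg-positive F n C zero)
... | K , 2^K≤d , d<2^K+1 =
  program , computes-output , ^log₂-bound m K (2 * Circ.formalDegree F n C) (ℕP.*-monoʳ-≤ 2 2^K≤d) ,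
  depth-bound , valid-labels , small-constants
  where open Construction F n m C K d<2^K+1 binary
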